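{- For each $n\ge 0$, the bilinear operation $*$ on ${\bf PQSym}_n$ defined on the basis by $$ {\bf F}_{{\bf a}'} * {\bf F}_{{\bf a}''} = {\bf F}_{{\rm Park}({\bf a}'\otimes{\bf a}'')}\qquad({\bf a}',{\bf a}''\in {\rm PF}_n)$$ is associative. Equivalently, the dual map $\delta:{\bf PQSym}_n^*\to{\bf PQSym}_n^*\otimes{\bf PQSym}_n^*$, $$\delta({\bf G}_{\bf a})=\sum_{{\bf a}',{\bf a}''\in{\rm PF}_n,\ {\rm Park}({\bf a}'\otimes{\bf a}'')={\bf a}} {\bf G}_{{\bf a}'}\otimes{\bf G}_{{\bf a}''},$$ is a coassociative coproduct. Moreover, in the polynomial realization, $\delta({\bf G}_{\bf a})={\bf G}_{\bf a}(A'A'')$; that is, $$\sum_{u,v\in \mathbb{Z}_{>0}^n,\ {\rm Park}(u\otimes v)={\bf a}} u\otimes v=\sum_{{\rm Park}({\bf a}'\otimes{\bf a}'')={\bf a}}{\bf G}_{{\bf a}'}(A')\otimes{\bf G}_{{\bf a}''}(A'').$$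
   Context: A parking function of length $n$ is a word ${\bf a}=a_1\cdots a_n$ of positive integers whose non-decreasing rearrangement $a'_1\le\cdots\le a'_n$ satisfies $a'_i\le i$ for all $i$; ${\rm PF}_n$ is the set of these. Parkization: let $B$ be a totally ordered set in which every element $x$ has an immediate successor; for $x<y$ in $B$ let $\delta(x,y)\in\mathbb{N}\cup\{\infty\}$ be the number of successor steps needed to go from $x$ to $y$ ($\infty$ if $y$ is never reached). For a word $w=w_1\cdots w_n$ over $B$ with distinct letters $b_1<\cdots<b_k$, set $p(b_1)=1$ and $p(b_{j+1})=\min\big(p(b_j)+\delta(b_j,b_{j+1}),\,1+\#\{i: w_i\le b_j\}\big)$; then ${\rm Park}(w)=p(w_1)\cdots p(w_n)$, a parking function. (For words over positive integers with the usual order, $\delta(x,y)=y-x$; equivalently ${\rm Park}(w)$ is obtained by repeatedly taking $d(w)=\min\{i:\#\{j: w_j\le i\}<i\}$ and, if $d(w)\le n$, decrementing all letters greater than $d(w)$.) For words $u=u_1\cdots u_n$, $v=v_1\cdots v_n$ of positive integers, $u\otimes v$ denotes the word $(u_1,v_1)\cdots(u_n,v_n)$ over $\mathbb{Z}_{>0}\times\mathbb{Z}_{>0}$ with the lexicographic order (successor of $(i,j)$ is $(i,j+1)$). ${\bf PQSym}_n$ is the vector space with basis $({\bf F}_{\bf a})_{{\bf a}\in{\rm PF}_n}$, ${\bf PQSym}_n^*$ its dual with dual basis $({\bf G}_{\bf a})$. Polynomial realization: for a totally ordered infinite alphabet $A$ (isomorphic to the positive integers) of noncommuting variables, ${\bf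 G}_{\bf a}(A)=\sum_{w\in A^*,\ {\rm Park}(w)={\bf a}} w$. Here $A'$, $A''$ are two copies of this alphabet, each noncommutative, commuting with each other; $A'A''$ is $A'\times A''$ with the lexicographic order, and words of the same length $u$ over $A'$, $v$ over $A''$ are identified with $u\otimes v$ over $A'A''$. -}

module Defs where

open import Data.Bool using (Bool; true; false; _∧_; if_then_else_; T)
open import Data.Nat using (ℕ; zero; suc; _+_; _∸_; _⊓_; _≤ᵇ_; _<ᵇ_; _≡ᵇ_)
import Data.Nat as ℕ
open import Data.Integer as ℤ using (ℤ)
open import Data.List as List using (List; []; _∷_; length; filterᵇ; concatMap; mapMaybe)
open import Data.Vec as Vec using (Vec; []; _∷_; toList; zip)
open import Data.Vec.Properties using (≡-dec)
open import Data.Maybe using (Maybe; just; nothing)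
open import Data.Product using (Σ; _×_; _,_; proj₁; proj₂)
open import Relation.Nullary using (Dec; yes; no; does)
open import Relation.Nullary.Decidable using (T?)
open import Relation.Binary.PropositionalEquality using (_≡_)
open import Data.Vec.Relation.Unary.All using (All)

data Cmp : Set where
  LT EQ GT : Cmp

cmpℕ : ℕ → ℕ → Cmp
cmpℕ zero    zero    = EQ
cmpℕ zero    (suc _) = LT
cmpℕ (suc _) zero    = GT
cmpℕ (suc m) (suc n) = cmpℕ m n

cmpLex : ℕ × ℕ → ℕ × ℕ → Cmp
cmpLex (i , j) (i' , j') with cmpℕ i i'
... | LT = LT
... | GT = GT
... | EQ = cmpℕ j j'

-- Generic parkization over a totally ordered set B (given by a
-- three-way comparison) together with the successor distance
-- δ : B → B → ℕ ∪ {∞}  (nothing = ∞), as in the paper.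

module ParkGen {B : Set} (cmp : B → B → Cmp) (δ : B → B → Maybe ℕ) where

  leᵇ : B → B → Bool
  leᵇ x y with cmp x y
  ... | GT = false
  ... | _  = true

  insertD : B → List B → List B
  insertD x [] = x ∷ []
  insertD x (y ∷ ys) with cmp x y
  ... | LT = x ∷ y ∷ ys
  ... | EQ = y ∷ ys
  ... | GT = y ∷ insertD x ys

  letters : List B → List B
  letters = List.foldr insertD []

  cntLe : List B → B → ℕ
  cntLe w b = length (filterᵇ (λ x → leᵇ x b) w)

  minδ : Maybe ℕ → ℕ → ℕ → ℕ
  minδ nothing  p m = m
  minδ (just d) p m = (p + d) ⊓ m

  go : List B → B → ℕ → List B → List (B × ℕ)
  go w b p []       = []
  go w b p (c ∷ cs) = (c , q) ∷ go w c q cs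
    where q = minδ (δ b c) p (suc (cntLe w b))

  table : List B → List (B × ℕ)
  table w with letters w
  ... | []       = []
  ... | b ∷ bs   = (b , 1) ∷ go w b 1 bs

  lookupT : List (B × ℕ) → B → ℕ
  lookupT [] x = 0
  lookupT ((b , p) ∷ t) x with cmp x b
  ... | EQ = p
  ... | _  = lookupT t x

  Park : ∀ {n} → Vec B n → Vec ℕ n
  Park w = Vec.map (lookupT (table (toList w))) w

δℕ : ℕ → ℕ → Maybe ℕ
δℕ x y = just (y ∸ x)

-- words over ℤ_{>0} × ℤ_{>0} with lex order: successor of (i,j) is (i,j+1)
δLex : ℕ × ℕ → ℕ × ℕ → Maybe ℕ
δLex (i , j) (i' , j') = if i ≡ᵇ i' then just (j' ∸ j) else nothing

Park : ∀ {n} → Vec ℕ n → Vec ℕ n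
Park = ParkGen.Park cmpℕ δℕ

ParkLex : ∀ {n} → Vec (ℕ × ℕ) n → Vec ℕ n
ParkLex = ParkGen.Park cmpLex δLex

_⊗_ : ∀ {n} → Vec ℕ n → Vec ℕ n → Vec (ℕ × ℕ) n
u ⊗ v = zip u v

insertℕ : ℕ → List ℕ → List ℕ
insertℕ x [] = x ∷ []
insertℕ x (y ∷ ys) = if x ≤ᵇ y then x ∷ y ∷ ys else y ∷ insertℕ x ys

sortℕ : List ℕ → List ℕ
sortℕ = List.foldr insertℕ []

pfCheck : ℕ → List ℕ → Bool
pfCheck i [] = true
pfCheck i (x ∷ xs) = (1 ≤ᵇ x) ∧ (x ≤ᵇ i) ∧ pfCheck (suc i) xs

isPF : ∀ {n} → Vec ℕ n → Bool
isPF a = pfCheck 1 (sortℕ (toList a))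

PF : ℕ → Set
PF n = Σ (Vec ℕ n) (λ a → T (isPF a))

allWords : (n : ℕ) → ℕ → List (Vec ℕ n)
allWords zero    m = [] ∷ []
allWords (suc k) m = concatMap (λ x → List.map (x ∷_) (allWords k m)) (List.map suc (List.upTo m))

toPF : ∀ {n} → Vec ℕ n → Maybe (PF n)
toPF a with T? (isPF a)
... | yes p = just (a , p)
... | no _  = nothing

pfs : (n : ℕ) → List (PF n)
pfs n = mapMaybe toPF (allWords n n)

_≟w_ : ∀ {n} → (u v : Vec ℕ n) → Dec (u ≡ v)
_≟w_ = ≡-dec ℕ._≟_

[_≡w_] : ∀ {n} → Vec ℕ n → Vec ℕ n → ℕ
[ u ≡w v ] = if does (u ≟w v) then 1 else 0

sumℤ : List ℤ → ℤ
sumℤ = List.foldr ℤ._+_ (ℤ.+ 0)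

sumℕ : List ℕ → ℕ
sumℕ = List.foldr _+_ 0

-- PQSym_n (over ℤ): an element is its coefficient vector on the basis F_a, a ∈ PF_n

PQSym : ℕ → Set
PQSym n = PF n → ℤ

-- bilinear extension of F_a' * F_a'' = F_{Park(a' ⊗ a'')}
_*_ : ∀ {n} → PQSym n → PQSym n → PQSym n
(x * y) c = sumℤ (concatMap (λ a → List.map (λ b →
               if does (ParkLex (proj₁ a ⊗ proj₁ b) ≟w proj₁ c)
               then x a ℤ.* y b else ℤ.+ 0) (pfs _)) (pfs _))

-- coefficient of G_a ⊗ G_b ⊗ G_c in (δ ⊗ id) δ (G_d)
coassocL : ∀ {n} → PF n → PF n → PF n → PF n → ℕ
coassocL a b c d = sumℕ (List.map (λ e →
  [ ParkLex (proj₁ a ⊗ proj₁ b) ≡w proj₁ e ] ℕ.* [ ParkLex (proj₁ e ⊗ proj₁ c) ≡w proj₁ d ]) (pfs _))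

-- coefficient of G_a ⊗ G_b ⊗ G_c in (id ⊗ δ) δ (G_d)
coassocR : ∀ {n} → PF n → PF n → PF n → PF n → ℕ
coassocR a b c d = sumℕ (List.map (λ e →
  [ ParkLex (proj₁ b ⊗ proj₁ c) ≡w proj₁ e ] ℕ.* [ ParkLex (proj₁ a ⊗ proj₁ e) ≡w proj₁ d ]) (pfs _))

-- Polynomial realization: coefficients of the word u ⊗ v (u, v words over
-- ℤ_{>0} of length n) in both sides of δ(G_a) = G_a(A'A'').

Positive : ∀ {n} → Vec ℕ n → Set
Positive u = All (λ x → 1 ℕ.≤ x) u

-- coefficient of u ⊗ v in G_a(A'A'') = Σ_{Park(u⊗v)=a} u ⊗ v
coeffLHS : ∀ {n} → PF n → Vec ℕ n → Vec ℕ n → ℕ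
coeffLHS a u v = [ ParkLex (u ⊗ v) ≡w proj₁ a ]

-- coefficient of u ⊗ v in Σ_{Park(a'⊗a'')=a} G_a'(A') ⊗ G_a''(A'')
coeffRHS : ∀ {n} → PF n → Vec ℕ n → Vec ℕ n → ℕ
coeffRHS a u v = sumℕ (concatMap (λ a' → List.map (λ a'' →
    [ ParkLex (proj₁ a' ⊗ proj₁ a'') ≡w proj₁ a ] ℕ.* [ Park u ≡w proj₁ a' ] ℕ.* [ Park v ≡w proj₁ a'' ])
    (pfs _)) (pfs _))

-- Parkization has a closed form.  Over ℕ, a letter x of w is sent to 1 + rank x,
-- where rank x = min over k ≤ x of (#{letters < k} + x − k); over pairs, (i , j) is
-- sent to 1 + #{letters in rows before i} + the rank of j within row i.
-- Two consequences carry the proof.  Parkizing both coordinates first does not change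
-- Park (u ⊗ v), because a sublist keeps its ranks when relabelled by the ranks of the
-- whole list.  Encoding (a , b) as a·K + b with K large turns lexicographic
-- parkization into parkization over ℕ.  For parking functions a, b, c, which Park fixes,
-- both Park (Park (a ⊗ b) ⊗ c) and Park (a ⊗ Park (b ⊗ c)) are therefore the
-- parkization of a·K² + b·K + c.  Associativity of * and coassociativity of δ follow by
-- expanding the structure constants, and the polynomial realization is the identity
-- Park (u ⊗ v) = Park (Park u ⊗ Park v).

module Submission where

open import Defs
open import Algebra.Structures using (IsCommutativeSemiring)
open import Data.Bool using (Bool; true; false; T; _∧_; _∨_; if_then_else_)
open import Data.Bool.Properties using (T-∧)
open import Data.Empty using (⊥-elim)
open import Data.Integer as ℤ using (ℤ)
import Data.Integer.Properties as ℤ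
open import Data.List using (List; []; _∷_; map; length; foldr; filterᵇ; concatMap; mapMaybe; applyUpTo; upTo; _++_)
import Data.List.Properties as List
open import Data.List.Membership.Propositional using (_∈_; _∉_)
open import Data.List.Membership.Propositional.Properties using (∈-map⁺; ∈-map⁻)
open import Data.List.Relation.Binary.Permutation.Propositional using (_↭_; prep; swap; ↭-refl; ↭-trans; ↭-sym)
open import Data.List.Relation.Binary.Permutation.Propositional.Properties using (∈-resp-↭; ↭-length; filter-↭)
open import Data.List.Relation.Binary.Sublist.Propositional using (_⊆_; []; _∷_; _∷ʳ_)
open import Data.List.Relation.Binary.Sublist.Propositional.Properties using (Any-resp-⊆; map⁺; filter-⊆)
open import Data.List.Relation.Unary.All as All using (All; []; _∷_)
open import Data.List.Relation.Unary.AllPairs using (AllPairs; []; _∷_)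
open import Data.List.Relation.Unary.Any using (here; there)
open import Data.Maybe using (Maybe)
open import Data.Nat hiding (_*_)
import Data.Nat as ℕ
open import Data.Nat.Properties
open import Data.Nat.Tactic.RingSolver using (solve-∀)
open import Data.List.Membership.DecPropositional _≟_ using (_∈?_)
open import Data.Product as Product using (_×_; _,_; proj₁; proj₂; ∃; ∃₂)
open import Data.Sum using (_⊎_; inj₁; inj₂)
open import Data.Unit using (tt)
open import Data.Vec as Vec using (Vec; toList)
import Data.Vec.Properties as Vec
open import Function using (_∘_; id; Equivalence)
open import Relation.Binary.Definitions using (DecidableEquality; tri<; tri≈; tri>)
open import Relation.Binary.PropositionalEquality
open import Relation.Nullary using (¬_; yes; no; does)
open import Relation.Nullary.Decidable using (T?)
open import Relation.Nullary.Reflects using (Reflects; ofʸ; ofⁿ)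

indicator : Bool → ℕ
indicator true  = 1
indicator false = 0

count : {A : Set} → (A → Bool) → List A → ℕ
count p xs = length (filterᵇ p xs)

module _ {A : Set} (p : A → Bool) where

  count-cons : ∀ x xs → count p (x ∷ xs) ≡ indicator (p x) + count p xs
  count-cons x xs with p x
  ... | true  = refl
  ... | false = refl

  count-accept : ∀ {x} xs → p x ≡ true → count p (x ∷ xs) ≡ suc (count p xs)
  count-accept {x} xs px = trans (count-cons x xs) (cong (λ b → indicator b + count p xs) px)

  count-reject : ∀ {x} xs → p x ≡ false → count p (x ∷ xs) ≡ count p xs
  count-reject {x} xs px = trans (count-cons x xs) (cong (λ b → indicator b + count p xs) px)

  count≤length : ∀ xs → count p xs ≤ length xs
  count≤length []       = z≤n
  count≤length (x ∷ xs) with p x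
  ... | true  = s≤s (count≤length xs)
  ... | false = m≤n⇒m≤1+n (count≤length xs)

  count≡0 : ∀ xs → (∀ {z} → z ∈ xs → p z ≡ false) → count p xs ≡ 0
  count≡0 []       _     = refl
  count≡0 (x ∷ xs) none = trans (count-reject xs (none (here refl))) (count≡0 xs (none ∘ there))

module _ {A : Set} (p q : A → Bool) where

  count-cong : ∀ xs → (∀ {z} → z ∈ xs → p z ≡ q z) → count p xs ≡ count q xs
  count-cong []       _  = refl
  count-cong (x ∷ xs) eq = begin
    count p (x ∷ xs)                 ≡⟨ count-cons p x xs ⟩
    indicator (p x) + count p xs     ≡⟨ cong₂ (λ b n → indicator b + n) (eq (here refl)) (count-cong xs (eq ∘ there)) ⟩
    indicator (q x) + count q xs     ≡⟨ count-cons q x xs ⟨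
    count q (x ∷ xs)                 ∎
    where open ≡-Reasoning

  Implies : List A → Set
  Implies xs = ∀ {z} → z ∈ xs → p z ≡ true → q z ≡ true

  count-mono : ∀ xs → Implies xs → count p xs ≤ count q xs
  count-mono []       _   = z≤n
  count-mono (x ∷ xs) p⇒q with p x in px | q x in qx
  ... | true  | true  = s≤s (count-mono xs (p⇒q ∘ there))
  ... | false | true  = m≤n⇒m≤1+n (count-mono xs (p⇒q ∘ there))
  ... | false | false = count-mono xs (p⇒q ∘ there)
  ... | true  | false with () ← trans (sym (p⇒q (here refl) px)) qx

  count-mono-< : ∀ xs {a} → a ∈ xs → p a ≡ false → q a ≡ true → Implies xs →
                 count p xs < count q xs
  count-mono-< (x ∷ xs) (here refl) pa qa p⇒q
    rewrite count-reject p xs pa | count-accept q xs qa = s≤s (count-mono xs (p⇒q ∘ there))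
  count-mono-< (x ∷ xs) (there a∈) pa qa p⇒q with p x in px | q x in qx
  ... | true  | true  = s≤s (count-mono-< xs a∈ pa qa (p⇒q ∘ there))
  ... | false | true  = m≤n⇒m≤1+n (count-mono-< xs a∈ pa qa (p⇒q ∘ there))
  ... | false | false = count-mono-< xs a∈ pa qa (p⇒q ∘ there)
  ... | true  | false with () ← trans (sym (p⇒q (here refl) px)) qx

count-map : ∀ {A B : Set} (p : B → Bool) (f : A → B) xs → count p (map f xs) ≡ count (p ∘ f) xs
count-map p f []       = refl
count-map p f (x ∷ xs) with p (f x)
... | true  = cong suc (count-map p f xs)
... | false = count-map p f xs

<⇒<ᵇ≡true : ∀ {m n} → m < n → (m <ᵇ n) ≡ true
<⇒<ᵇ≡true {m} {n} m<n with m <ᵇ n in eq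
... | true  = refl
... | false = ⊥-elim (subst T eq (<⇒<ᵇ m<n))

≮⇒<ᵇ≡false : ∀ {m n} → ¬ m < n → (m <ᵇ n) ≡ false
≮⇒<ᵇ≡false {m} {n} m≮n with m <ᵇ n in eq
... | true  = ⊥-elim (m≮n (<ᵇ⇒< m n (subst T (sym eq) tt)))
... | false = refl

<ᵇ≡true⇒< : ∀ {m n} → (m <ᵇ n) ≡ true → m < n
<ᵇ≡true⇒< {m} {n} eq = <ᵇ⇒< m n (subst T (sym eq) tt)

≡⇒≡ᵇ≡true : ∀ {m n} → m ≡ n → (m ≡ᵇ n) ≡ true
≡⇒≡ᵇ≡true {m} {n} m≡n with m ≡ᵇ n in eq
... | true  = refl
... | false = ⊥-elim (subst T eq (≡⇒≡ᵇ m n m≡n))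

≢⇒≡ᵇ≡false : ∀ {m n} → m ≢ n → (m ≡ᵇ n) ≡ false
≢⇒≡ᵇ≡false {m} {n} m≢n with m ≡ᵇ n in eq
... | true  = ⊥-elim (m≢n (≡ᵇ⇒≡ m n (subst T (sym eq) tt)))
... | false = refl

≡ᵇ≡true⇒≡ : ∀ {m n} → (m ≡ᵇ n) ≡ true → m ≡ n
≡ᵇ≡true⇒≡ {m} {n} eq = ≡ᵇ⇒≡ m n (subst T (sym eq) tt)

-- Ranks

countBelow : List ℕ → ℕ → ℕ
countBelow xs k = count (_<ᵇ k) xs

-- rank xs j = min { countBelow xs k + (j ∸ k) ∣ k ≤ j }
rank : List ℕ → ℕ → ℕ
rank xs zero    = 0
rank xs (suc j) = suc (rank xs j) ⊓ countBelow xs (suc j)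

parkValue : List ℕ → ℕ → ℕ
parkValue xs = suc ∘ rank xs

module _ (xs : List ℕ) where

  countBelow-zero : countBelow xs 0 ≡ 0
  countBelow-zero = count≡0 (_<ᵇ 0) xs (λ _ → refl)

  countBelow-mono : ∀ {k k'} → k ≤ k' → countBelow xs k ≤ countBelow xs k'
  countBelow-mono k≤k' = count-mono _ _ xs (λ _ z<k → <⇒<ᵇ≡true (<-≤-trans (<ᵇ≡true⇒< z<k) k≤k'))

  countBelow-mono-< : ∀ {a k} → a ∈ xs → a < k → countBelow xs a < countBelow xs k
  countBelow-mono-< {a} a∈ a<k = count-mono-< _ _ xs a∈ (≮⇒<ᵇ≡false {a} (<-irrefl refl)) (<⇒<ᵇ≡true a<k)
    (λ _ z<a → <⇒<ᵇ≡true (<-trans (<ᵇ≡true⇒< z<a) a<k))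

  rank≤countBelow : ∀ j → rank xs j ≤ countBelow xs j
  rank≤countBelow zero    = z≤n
  rank≤countBelow (suc j) = m⊓n≤n _ _

  rank-suc≤ : ∀ j → rank xs (suc j) ≤ suc (rank xs j)
  rank-suc≤ j = m⊓n≤m _ _

  rank-+≤ : ∀ d j → rank xs (d + j) ≤ d + rank xs j
  rank-+≤ zero    j = ≤-refl
  rank-+≤ (suc d) j = ≤-trans (rank-suc≤ (d + j)) (s≤s (rank-+≤ d j))

  rank-+≤countBelow : ∀ d k → rank xs (d + k) ≤ countBelow xs k + d
  rank-+≤countBelow d k = begin
    rank xs (d + k)       ≤⟨ rank-+≤ d k ⟩
    d + rank xs k         ≤⟨ +-monoʳ-≤ d (rank≤countBelow k) ⟩
    d + countBelow xs k   ≡⟨ +-comm d _ ⟩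
    countBelow xs k + d   ∎
    where open ≤-Reasoning

  rank-attained : ∀ j → ∃₂ λ k d → d + k ≡ j × rank xs j ≡ countBelow xs k + d
  rank-attained zero = 0 , 0 , refl , sym (trans (+-identityʳ _) countBelow-zero)
  rank-attained (suc j) with rank-attained j | ⊓-sel (suc (rank xs j)) (countBelow xs (suc j))
  ... | k , d , refl , eq | inj₁ left  = k , suc d , refl , trans left (trans (cong suc eq) (sym (+-suc _ d)))
  ... | _ | inj₂ right = suc j , 0 , refl , trans right (sym (+-identityʳ _))

  rank-mono : ∀ {j j'} → j ≤ j' → rank xs j ≤ rank xs j'
  rank-mono {j} {j'} j≤j' with m≤n⇒∃[o]m+o≡n j≤j'
  ... | d , refl = go d
    where
      go : ∀ d → rank xs j ≤ rank xs (j + d)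
      go zero    = ≤-reflexive (cong (rank xs) (sym (+-identityʳ j)))
      go (suc d) = ≤-trans (go d) (subst (λ t → rank xs (j + d) ≤ rank xs t) (sym (+-suc j d))
                     (⊓-glb (n≤1+n _) (≤-trans (rank≤countBelow (j + d)) (countBelow-mono (n≤1+n _)))))

  -- If the minimum defining rank xs x is attained at some k ≤ a, the slack
  -- x ∸ a is added on top of rank xs a; otherwise the letter a itself is counted.
  rank-mono-< : ∀ {a x} → a ∈ xs → a < x → rank xs a < rank xs x
  rank-mono-< {a} {x} a∈ a<x with rank-attained x
  ... | k , d , d+k≡x , eq with k ≤? a
  ... | no  k≰a = begin-strict
    rank xs a             ≤⟨ rank≤countBelow a ⟩
    countBelow xs a       <⟨ countBelow-mono-< a∈ (≰⇒> k≰a) ⟩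
    countBelow xs k       ≤⟨ m≤m+n _ d ⟩
    countBelow xs k + d   ≡⟨ eq ⟨
    rank xs x             ∎
    where open ≤-Reasoning
  ... | yes k≤a with m≤n⇒∃[o]m+o≡n k≤a
  ... | c , refl = begin-strict
    rank xs (k + c)       ≡⟨ cong (rank xs) (+-comm k c) ⟩
    rank xs (c + k)       ≤⟨ rank-+≤countBelow c k ⟩
    countBelow xs k + c   <⟨ +-monoʳ-< _ c<d ⟩
    countBelow xs k + d   ≡⟨ eq ⟨
    rank xs x             ∎
    where
      open ≤-Reasoning
      c<d : c < d
      c<d = +-cancelˡ-< k c d (subst (k + c <_) (trans (sym d+k≡x) (+-comm d k)) a<x)

  rank≡0 : ∀ j → countBelow xs j ≡ 0 → rank xs j ≡ 0
  rank≡0 j eq = n≤0⇒n≡0 (subst (rank xs j ≤_) eq (rank≤countBelow j))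

  rank-across-gap : ∀ y d c → (∀ e → e ≤ d → countBelow xs (suc (e + y)) ≡ c) →
                    rank xs (suc (d + y)) ≡ suc (d + rank xs y) ⊓ c
  rank-across-gap y zero    c flat = cong (suc (rank xs y) ⊓_) (flat 0 z≤n)
  rank-across-gap y (suc d) c flat = begin
    suc (rank xs (suc (d + y))) ⊓ countBelow xs (suc (suc d + y))
      ≡⟨ cong₂ _⊓_ (cong suc (rank-across-gap y d c (λ e e≤d → flat e (m≤n⇒m≤1+n e≤d))))
                   (flat (suc d) ≤-refl) ⟩
    (suc (suc (d + rank xs y)) ⊓ suc c) ⊓ c
      ≡⟨ ⊓-assoc _ (suc c) c ⟩
    suc (suc (d + rank xs y)) ⊓ (suc c ⊓ c)
      ≡⟨ cong (suc (suc (d + rank xs y)) ⊓_) (m≥n⇒m⊓n≡n (n≤1+n c)) ⟩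
    suc (suc d + rank xs y) ⊓ c
      ∎
    where open ≡-Reasoning

countBelow-skip : ∀ xs {k} → k ∉ xs → countBelow xs (suc k) ≡ countBelow xs k
countBelow-skip xs {k} k∉ = count-cong _ _ xs agree
  where
    agree : ∀ {z} → z ∈ xs → (z <ᵇ suc k) ≡ (z <ᵇ k)
    agree {z} z∈ with <-cmp z k
    ... | tri< z<k _ _ = trans (<⇒<ᵇ≡true (m<n⇒m<1+n z<k)) (sym (<⇒<ᵇ≡true z<k))
    ... | tri≈ _ refl _ = ⊥-elim (k∉ z∈)
    ... | tri> _ _ z>k = trans (≮⇒<ᵇ≡false (<⇒≱ (s≤s z>k))) (sym (≮⇒<ᵇ≡false (<⇒≯ z>k)))

next-letter : ∀ xs {j} → j ∈ xs → ∀ d k → d + k ≡ j →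
              ∃ λ l → l ∈ xs × k ≤ l × l ≤ j × countBelow xs l ≡ countBelow xs k
next-letter xs j∈ zero    k refl = k , j∈ , ≤-refl , ≤-refl , refl
next-letter xs j∈ (suc d) k eq with k ∈? xs
... | yes k∈ = k , k∈ , ≤-refl , subst (k ≤_) eq (m≤n+m k (suc d)) , refl
... | no  k∉ with next-letter xs j∈ d (suc k) (trans (+-suc d k) eq)
... | l , l∈ , k<l , l≤j , same = l , l∈ , ≤-trans (n≤1+n k) k<l , l≤j , trans same (countBelow-skip xs k∉)

countBelow-gap : ∀ xs {b c} → (∀ {z} → z ∈ xs → b < z → ¬ z < c) →
                 ∀ {k} → b < k → k ≤ c → countBelow xs k ≡ countBelow xs (suc b)
countBelow-gap xs {b} {c} gap {k} b<k k≤c = count-cong _ _ xs agree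
  where
    agree : ∀ {z} → z ∈ xs → (z <ᵇ k) ≡ (z <ᵇ suc b)
    agree {z} z∈ with z ≤? b
    ... | yes z≤b = trans (<⇒<ᵇ≡true (≤-<-trans z≤b b<k)) (sym (<⇒<ᵇ≡true (s≤s z≤b)))
    ... | no  z≰b = trans (≮⇒<ᵇ≡false (λ z<k → gap z∈ (≰⇒> z≰b) (<-≤-trans z<k k≤c)))
                          (sym (≮⇒<ᵇ≡false (z≰b ∘ ≤-pred)))

rank-next : ∀ xs {b c} → b < c → (∀ {z} → z ∈ xs → b < z → ¬ z < c) →
            suc (rank xs c) ≡ (suc (rank xs b) + (c ∸ b)) ⊓ suc (countBelow xs (suc b))
rank-next xs {b} b<c gap with m≤n⇒∃[o]m+o≡n b<c
... | d , refl = begin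
  suc (rank xs (suc b + d))                  ≡⟨ cong (suc ∘ rank xs ∘ suc) (+-comm b d) ⟩
  suc (rank xs (suc (d + b)))                ≡⟨ cong suc (rank-across-gap xs b d C flat) ⟩
  suc (suc (d + rank xs b)) ⊓ suc C          ≡⟨ cong (λ t → suc t ⊓ suc C) (+-comm (suc d) (rank xs b)) ⟩
  (suc (rank xs b) + suc d) ⊓ suc C          ≡⟨ cong (λ t → (suc (rank xs b) + t) ⊓ suc C) steps ⟩
  (suc (rank xs b) + (suc b + d ∸ b)) ⊓ suc C ∎
  where
    open ≡-Reasoning
    C = countBelow xs (suc b)
    steps : suc d ≡ suc b + d ∸ b
    steps = trans (sym (m+n∸m≡n b (suc d))) (cong (_∸ b) (+-suc b d))
    flat : ∀ e → e ≤ d → countBelow xs (suc (e + b)) ≡ C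
    flat e e≤d = countBelow-gap xs gap (s≤s (m≤n+m b e))
                   (subst (_≤ suc b + d) (cong suc (+-comm b e)) (s≤s (+-monoʳ-≤ b e≤d)))

-- Parkization through its defining recursion

Vec-map-cong-∈ : ∀ {A B : Set} {n} {f g : A → B} (v : Vec A n) →
                 (∀ {x} → x ∈ toList v → f x ≡ g x) → Vec.map f v ≡ Vec.map g v
Vec-map-cong-∈ Vec.[]       _  = refl
Vec-map-cong-∈ (x Vec.∷ v) f≡g = cong₂ Vec._∷_ (f≡g (here refl)) (Vec-map-cong-∈ v (f≡g ∘ there))

data Compares {B : Set} (_≺_ : B → B → Set) (x y : B) : Cmp → Set where
  less    : x ≺ y → Compares _≺_ x y LT
  equal   : x ≡ y → Compares _≺_ x y EQ
  greater : y ≺ x → Compares _≺_ x y GT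

module ParkByTable {B : Set} (cmp : B → B → Cmp) (δ : B → B → Maybe ℕ)
  {_≺_ : B → B → Set} (≺-irrefl : ∀ {x} → ¬ x ≺ x) (≺-trans : ∀ {x y z} → x ≺ y → y ≺ z → x ≺ z)
  (compares : ∀ x y → Compares _≺_ x y (cmp x y)) where

  open ParkGen cmp δ hiding (Park)

  Sorted : List B → Set
  Sorted = AllPairs _≺_

  ≺-asym : ∀ {x y} → x ≺ y → ¬ y ≺ x
  ≺-asym x≺y y≺x = ≺-irrefl (≺-trans x≺y y≺x)

  insertD-∈⁻ : ∀ x ys {z} → z ∈ insertD x ys → z ≡ x ⊎ z ∈ ys
  insertD-∈⁻ x []       (here z≡x) = inj₁ z≡x
  insertD-∈⁻ x (y ∷ ys) z∈ with cmp x y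
  insertD-∈⁻ x (y ∷ ys) (here z≡x)  | LT = inj₁ z≡x
  insertD-∈⁻ x (y ∷ ys) (there z∈)  | LT = inj₂ z∈
  insertD-∈⁻ x (y ∷ ys) z∈          | EQ = inj₂ z∈
  insertD-∈⁻ x (y ∷ ys) (here z≡y)  | GT = inj₂ (here z≡y)
  insertD-∈⁻ x (y ∷ ys) (there z∈)  | GT with insertD-∈⁻ x ys z∈
  ... | inj₁ z≡x = inj₁ z≡x
  ... | inj₂ z∈' = inj₂ (there z∈')

  insertD-∈⁺ : ∀ x ys {z} → z ≡ x ⊎ z ∈ ys → z ∈ insertD x ys
  insertD-∈⁺ x []       (inj₁ z≡x) = here z≡x
  insertD-∈⁺ x (y ∷ ys) z∈ with cmp x y | compares x y
  insertD-∈⁺ x (y ∷ ys) (inj₁ z≡x)        | LT | _         = here z≡x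
  insertD-∈⁺ x (y ∷ ys) (inj₂ z∈)         | LT | _         = there z∈
  insertD-∈⁺ x (y ∷ ys) (inj₁ refl)       | EQ | equal x≡y = here x≡y
  insertD-∈⁺ x (y ∷ ys) (inj₂ z∈)         | EQ | _         = z∈
  insertD-∈⁺ x (y ∷ ys) (inj₁ z≡x)        | GT | _         = there (insertD-∈⁺ x ys (inj₁ z≡x))
  insertD-∈⁺ x (y ∷ ys) (inj₂ (here z≡y)) | GT | _         = here z≡y
  insertD-∈⁺ x (y ∷ ys) (inj₂ (there z∈)) | GT | _         = there (insertD-∈⁺ x ys (inj₂ z∈))

  insertD-All : ∀ {P : B → Set} {x} ys → P x → All P ys → All P (insertD x ys)
  insertD-All []       px []           = px ∷ []
  insertD-All {x = x} (y ∷ ys) px (py ∷ pys) with cmp x y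
  ... | LT = px ∷ py ∷ pys
  ... | EQ = py ∷ pys
  ... | GT = py ∷ insertD-All ys px pys

  insertD-sorted : ∀ x ys → Sorted ys → Sorted (insertD x ys)
  insertD-sorted x []       []              = [] ∷ []
  insertD-sorted x (y ∷ ys) (y≺ys ∷ sorted) with cmp x y | compares x y
  ... | LT | less x≺y    = (x≺y ∷ All.map (≺-trans x≺y) y≺ys) ∷ y≺ys ∷ sorted
  ... | EQ | _           = y≺ys ∷ sorted
  ... | GT | greater y≺x = insertD-All ys y≺x y≺ys ∷ insertD-sorted x ys sorted

  letters-∈⁻ : ∀ w {z} → z ∈ letters w → z ∈ w
  letters-∈⁻ (x ∷ w) z∈ with insertD-∈⁻ x (letters w) z∈
  ... | inj₁ z≡x = here z≡x
  ... | inj₂ z∈' = there (letters-∈⁻ w z∈')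

  letters-∈⁺ : ∀ w {z} → z ∈ w → z ∈ letters w
  letters-∈⁺ (x ∷ w) (here z≡x) = insertD-∈⁺ x (letters w) (inj₁ z≡x)
  letters-∈⁺ (x ∷ w) (there z∈) = insertD-∈⁺ x (letters w) (inj₂ (letters-∈⁺ w z∈))

  letters-sorted : ∀ w → Sorted (letters w)
  letters-sorted []      = []
  letters-sorted (x ∷ w) = insertD-sorted x (letters w) (letters-sorted w)

  module _ (w : List B) (Φ : B → ℕ)
    (Φ-least : ∀ {b} → b ∈ w → (∀ {z} → z ∈ w → ¬ z ≺ b) → Φ b ≡ 1)
    (Φ-next  : ∀ {b c} → b ∈ w → c ∈ w → b ≺ c → (∀ {z} → z ∈ w → b ≺ z → ¬ z ≺ c) →
               Φ c ≡ minδ (δ b c) (Φ b) (suc (cntLe w b))) where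

    Correct : List (B × ℕ) → Set
    Correct = All (λ entry → proj₂ entry ≡ Φ (proj₁ entry))

    lookupT-correct : ∀ t {x} → Correct t → x ∈ map proj₁ t → lookupT t x ≡ Φ x
    lookupT-correct ((b , p) ∷ t) {x} (p≡ ∷ ok) x∈ with cmp x b | compares x b | x∈
    ... | EQ | equal refl  | _         = p≡
    ... | LT | less x≺b    | here refl = ⊥-elim (≺-irrefl x≺b)
    ... | LT | _           | there x∈' = lookupT-correct t ok x∈'
    ... | GT | greater b≺x | here refl = ⊥-elim (≺-irrefl b≺x)
    ... | GT | _           | there x∈' = lookupT-correct t ok x∈'

    go-keys : ∀ b p cs → map proj₁ (go w b p cs) ≡ cs
    go-keys b p []       = refl
    go-keys b p (c ∷ cs) = cong (c ∷_) (go-keys c _ cs)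

    go-correct : ∀ b cs → b ∈ w → Sorted (b ∷ cs) → (∀ {c} → c ∈ cs → c ∈ w) →
                 (∀ {z} → z ∈ w → b ≺ z → z ∈ cs) → Correct (go w b (Φ b) cs)
    go-correct b []       _  _                           _  _     = []
    go-correct b (c ∷ cs) b∈ ((b≺c ∷ _) ∷ c≺cs ∷ sorted) ⊆w above =
      sym Φc ∷ subst (λ p → Correct (go w c p cs)) Φc
                 (go-correct c cs (⊆w (here refl)) (c≺cs ∷ sorted) (⊆w ∘ there) above')
      where
        nothing-between : ∀ {z} → z ∈ w → b ≺ z → ¬ z ≺ c
        nothing-between z∈ b≺z z≺c with above z∈ b≺z
        ... | here refl = ≺-irrefl z≺c
        ... | there z∈cs = ≺-asym z≺c (All.lookup c≺cs z∈cs)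
        Φc : Φ c ≡ minδ (δ b c) (Φ b) (suc (cntLe w b))
        Φc = Φ-next b∈ (⊆w (here refl)) b≺c nothing-between
        above' : ∀ {z} → z ∈ w → c ≺ z → z ∈ cs
        above' z∈ c≺z with above z∈ (≺-trans b≺c c≺z)
        ... | here refl = ⊥-elim (≺-irrefl c≺z)
        ... | there z∈cs = z∈cs

    table-correct : ∀ {x} → x ∈ w → lookupT (table w) x ≡ Φ x
    table-correct {x} x∈ with letters w in ≡ls
    ... | []     with () ← subst (x ∈_) ≡ls (letters-∈⁺ w x∈)
    ... | b ∷ bs = lookupT-correct _ correct keys
      where
        ∈ls⁺ : ∀ {z} → z ∈ w → z ∈ b ∷ bs
        ∈ls⁺ = subst (_ ∈_) ≡ls ∘ letters-∈⁺ w
        ∈ls⁻ : ∀ {z} → z ∈ b ∷ bs → z ∈ w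
        ∈ls⁻ = letters-∈⁻ w ∘ subst (_ ∈_) (sym ≡ls)
        sorted : Sorted (b ∷ bs)
        sorted = subst Sorted ≡ls (letters-sorted w)
        minimal : ∀ {z} → z ∈ w → ¬ z ≺ b
        minimal z∈ z≺b with ∈ls⁺ z∈ | sorted
        ... | here refl  | _         = ≺-irrefl z≺b
        ... | there z∈bs | b≺bs ∷ _ = ≺-asym z≺b (All.lookup b≺bs z∈bs)
        above : ∀ {z} → z ∈ w → b ≺ z → z ∈ bs
        above z∈ b≺z with ∈ls⁺ z∈
        ... | here refl  = ⊥-elim (≺-irrefl b≺z)
        ... | there z∈bs = z∈bs
        Φb : Φ b ≡ 1
        Φb = Φ-least (∈ls⁻ (here refl)) minimal
        correct : Correct ((b , 1) ∷ go w b 1 bs)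
        correct = sym Φb ∷ subst (λ p → Correct (go w b p bs)) Φb
                    (go-correct b bs (∈ls⁻ (here refl)) sorted (∈ls⁻ ∘ there) above)
        keys : x ∈ b ∷ map proj₁ (go w b 1 bs)
        keys = subst (λ cs → x ∈ b ∷ cs) (sym (go-keys b 1 bs)) (∈ls⁺ x∈)

  module _ (Φ : List B → B → ℕ)
    (Φ-least : ∀ {w b} → b ∈ w → (∀ {z} → z ∈ w → ¬ z ≺ b) → Φ w b ≡ 1)
    (Φ-next  : ∀ {w b c} → b ∈ w → c ∈ w → b ≺ c → (∀ {z} → z ∈ w → b ≺ z → ¬ z ≺ c) →
               Φ w c ≡ minδ (δ b c) (Φ w b) (suc (cntLe w b))) where

    Park≡map : ∀ {n} (w : Vec B n) → ParkGen.Park cmp δ w ≡ Vec.map (Φ (toList w)) w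
    Park≡map w = Vec-map-cong-∈ w (table-correct (toList w) (Φ (toList w)) Φ-least Φ-next)

cmpℕ-compares : ∀ m n → Compares _<_ m n (cmpℕ m n)
cmpℕ-compares zero    zero    = equal refl
cmpℕ-compares zero    (suc n) = less z<s
cmpℕ-compares (suc m) zero    = greater z<s
cmpℕ-compares (suc m) (suc n) with cmpℕ m n | cmpℕ-compares m n
... | LT | less m<n    = less (s<s m<n)
... | EQ | equal m≡n   = equal (cong suc m≡n)
... | GT | greater n<m = greater (s<s n<m)

module ParkℕGen = ParkGen cmpℕ δℕ

leᵇℕ≡<ᵇsuc : ∀ x b → ParkℕGen.leᵇ x b ≡ (x <ᵇ suc b)
leᵇℕ≡<ᵇsuc x b with cmpℕ x b | cmpℕ-compares x b
... | LT | less x<b    = sym (<⇒<ᵇ≡true (m<n⇒m<1+n x<b))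
... | EQ | equal refl  = sym (<⇒<ᵇ≡true (n<1+n x))
... | GT | greater b<x = sym (≮⇒<ᵇ≡false (<⇒≱ b<x ∘ ≤-pred))

Park≡parkValue : ∀ {n} (w : Vec ℕ n) → Park w ≡ Vec.map (parkValue (toList w)) w
Park≡parkValue = ParkByTable.Park≡map cmpℕ δℕ (<-irrefl refl) <-trans cmpℕ-compares
  parkValue least next
  where
    least : ∀ {xs b} → b ∈ xs → (∀ {z} → z ∈ xs → ¬ z < b) → suc (rank xs b) ≡ 1
    least {xs} {b} _ minimal = cong suc (rank≡0 xs b (count≡0 _ xs (≮⇒<ᵇ≡false ∘ minimal)))
    next : ∀ {xs b c} → b ∈ xs → c ∈ xs → b < c → (∀ {z} → z ∈ xs → b < z → ¬ z < c) →
           suc (rank xs c) ≡ (suc (rank xs b) + (c ∸ b)) ⊓ suc (ParkℕGen.cntLe xs b)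
    next {xs} {b} {c} _ _ b<c gap = trans (rank-next xs b<c gap)
      (cong (λ t → (suc (rank xs b) + (c ∸ b)) ⊓ suc t) (count-cong _ _ xs (λ {z} _ → sym (leᵇℕ≡<ᵇsuc z b))))

-- Lexicographic parkization

infix 4 _<ₗ_ _<ₗᵇ_

_<ₗ_ : ℕ × ℕ → ℕ × ℕ → Set
(a , b) <ₗ (i , j) = a < i ⊎ (a ≡ i × b < j)

<ₗ-irrefl : ∀ {x} → ¬ x <ₗ x
<ₗ-irrefl (inj₁ a<a)       = <-irrefl refl a<a
<ₗ-irrefl (inj₂ (_ , b<b)) = <-irrefl refl b<b

<ₗ-trans : ∀ {x y z} → x <ₗ y → y <ₗ z → x <ₗ z
<ₗ-trans (inj₁ p)          (inj₁ q)          = inj₁ (<-trans p q)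
<ₗ-trans (inj₁ p)          (inj₂ (refl , _)) = inj₁ p
<ₗ-trans (inj₂ (refl , _)) (inj₁ q)          = inj₁ q
<ₗ-trans (inj₂ (refl , p)) (inj₂ (refl , q)) = inj₂ (refl , <-trans p q)

cmpLex-compares : ∀ x y → Compares _<ₗ_ x y (cmpLex x y)
cmpLex-compares (i , j) (i' , j') with cmpℕ i i' | cmpℕ-compares i i'
... | LT | less i<i'    = less (inj₁ i<i')
... | GT | greater i'<i = greater (inj₁ i'<i)
... | EQ | equal refl with cmpℕ j j' | cmpℕ-compares j j'
...   | LT | less j<j'    = less (inj₂ (refl , j<j'))
...   | EQ | equal refl   = equal refl
...   | GT | greater j'<j = greater (inj₂ (refl , j'<j))

_<ₗᵇ_ : ℕ × ℕ → ℕ × ℕ → Bool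
(a , b) <ₗᵇ (i , j) = (a <ᵇ i) ∨ ((a ≡ᵇ i) ∧ (b <ᵇ j))

<ₗᵇ-reflects : ∀ x y → Reflects (x <ₗ y) (x <ₗᵇ y)
<ₗᵇ-reflects (a , b) (i , j) with <-cmp a i
... | tri< a<i _ _ rewrite <⇒<ᵇ≡true a<i = ofʸ (inj₁ a<i)
... | tri> _ _ a>i rewrite ≮⇒<ᵇ≡false (<⇒≯ a>i) | ≢⇒≡ᵇ≡false (≢-sym (<⇒≢ a>i)) =
  ofⁿ λ { (inj₁ a<i) → <⇒≯ a>i a<i ; (inj₂ (a≡i , _)) → <⇒≢ a>i (sym a≡i) }
... | tri≈ _ refl _ rewrite ≮⇒<ᵇ≡false {a} (<-irrefl refl) | ≡⇒≡ᵇ≡true {a} refl with b <? j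
...   | yes b<j rewrite <⇒<ᵇ≡true b<j = ofʸ (inj₂ (refl , b<j))
...   | no  b≮j rewrite ≮⇒<ᵇ≡false b≮j =
  ofⁿ λ { (inj₁ a<a) → <-irrefl refl a<a ; (inj₂ (_ , b<j)) → b≮j b<j }

firsts : List (ℕ × ℕ) → List ℕ
firsts = map proj₁

row : List (ℕ × ℕ) → ℕ → List ℕ
row L i = map proj₂ (filterᵇ (λ z → proj₁ z ≡ᵇ i) L)

∈-row⁻ : ∀ L {i v} → v ∈ row L i → (i , v) ∈ L
∈-row⁻ ((a , b) ∷ L) {i} v∈ with a ≡ᵇ i in a≡ᵇi
∈-row⁻ ((a , b) ∷ L) {i} (here refl) | true rewrite ≡ᵇ≡true⇒≡ {a} {i} a≡ᵇi = here refl
∈-row⁻ ((a , b) ∷ L) (there v∈)  | true  = there (∈-row⁻ L v∈)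
∈-row⁻ ((a , b) ∷ L) v∈          | false = there (∈-row⁻ L v∈)

∈-row⁺ : ∀ L {i v} → (i , v) ∈ L → v ∈ row L i
∈-row⁺ ((a , b) ∷ L) {i} (here refl) rewrite ≡⇒≡ᵇ≡true {i} refl = here refl
∈-row⁺ ((a , b) ∷ L) {i} (there iv∈) with a ≡ᵇ i
... | true  = there (∈-row⁺ L iv∈)
... | false = ∈-row⁺ L iv∈

count-<ₗ : ∀ L i k → count (_<ₗᵇ (i , k)) L ≡ countBelow (firsts L) i + countBelow (row L i) k
count-<ₗ []            i k = refl
count-<ₗ ((a , b) ∷ L) i k with <-cmp a i
... | tri< a<i _ _ rewrite <⇒<ᵇ≡true a<i | ≢⇒≡ᵇ≡false (<⇒≢ a<i) = cong suc (count-<ₗ L i k)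
... | tri> _ _ a>i rewrite ≮⇒<ᵇ≡false (<⇒≯ a>i) | ≢⇒≡ᵇ≡false (≢-sym (<⇒≢ a>i)) = count-<ₗ L i k
... | tri≈ _ refl _ rewrite ≮⇒<ᵇ≡false {a} (<-irrefl refl) | ≡⇒≡ᵇ≡true {a} refl with b <ᵇ k
...   | true  = trans (cong suc (count-<ₗ L a k)) (sym (+-suc _ _))
...   | false = count-<ₗ L a k

count-reflecting-<ₗ : ∀ (p : ℕ × ℕ → Bool) L i k → (∀ {z} → z ∈ L → Reflects (z <ₗ (i , k)) (p z)) →
                      count p L ≡ countBelow (firsts L) i + countBelow (row L i) k
count-reflecting-<ₗ p L i k reflects = trans (count-cong _ _ L agree) (count-<ₗ L i k)
  where
    agree : ∀ {z} → z ∈ L → p z ≡ (z <ₗᵇ (i , k))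
    agree {z} z∈ with p z | reflects z∈ | z <ₗᵇ (i , k) | <ₗᵇ-reflects z (i , k)
    ... | true  | _      | true  | _      = refl
    ... | false | _      | false | _      = refl
    ... | true  | ofʸ z< | false | ofⁿ z≮ = ⊥-elim (z≮ z<)
    ... | false | ofⁿ z≮ | true  | ofʸ z< = ⊥-elim (z≮ z<)

lexRank : List (ℕ × ℕ) → ℕ × ℕ → ℕ
lexRank L (i , j) = suc (countBelow (firsts L) i + rank (row L i) j)

module ParkLexGen = ParkGen cmpLex δLex

leᵇLex-reflects : ∀ z i j → Reflects (z <ₗ (i , suc j)) (ParkLexGen.leᵇ z (i , j))
leᵇLex-reflects z i j with cmpLex z (i , j) | cmpLex-compares z (i , j)
... | LT | less z<      = ofʸ (<ₗ-trans z< (inj₂ (refl , n<1+n j)))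
... | EQ | equal refl   = ofʸ (inj₂ (refl , n<1+n j))
... | GT | greater ij<z = ofⁿ (nothing-between ij<z)
  where
    nothing-between : ∀ {z} → (i , j) <ₗ z → ¬ z <ₗ (i , suc j)
    nothing-between (inj₁ i<a)          (inj₁ a<i)        = <-asym i<a a<i
    nothing-between (inj₁ i<a)          (inj₂ (refl , _)) = <-irrefl refl i<a
    nothing-between (inj₂ (refl , _))   (inj₁ a<a)        = <-irrefl refl a<a
    nothing-between (inj₂ (refl , j<b)) (inj₂ (_ , b<sj)) = <⇒≱ j<b (≤-pred b<sj)

≮ₗ-suc⇒>ₗ : ∀ {z i j} → ¬ z <ₗ (i , suc j) → (i , j) <ₗ z
≮ₗ-suc⇒>ₗ {a , b} {i} {j} z≮ with <-cmp i a
... | tri< i<a _ _  = inj₁ i<a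
... | tri> _ _ a<i  = ⊥-elim (z≮ (inj₁ a<i))
... | tri≈ _ refl _ with j <? b
...   | yes j<b = inj₂ (refl , j<b)
...   | no  j≮b = ⊥-elim (z≮ (inj₂ (refl , s≤s (≮⇒≥ j≮b))))

cntLe-lex : ∀ L i j → ParkLexGen.cntLe L (i , j) ≡ countBelow (firsts L) i + countBelow (row L i) (suc j)
cntLe-lex L i j = count-reflecting-<ₗ _ L i (suc j) (λ {z} _ → leᵇLex-reflects z i j)

lexRank-least : ∀ {L b} → b ∈ L → (∀ {z} → z ∈ L → ¬ z <ₗ b) → lexRank L b ≡ 1
lexRank-least {L} {i , j} _ minimal = cong suc (cong₂ _+_ none-before (rank≡0 (row L i) j none-in-row))
  where
    none-before : countBelow (firsts L) i ≡ 0
    none-before = trans (count-map _ proj₁ L) (count≡0 _ L (λ z∈ → ≮⇒<ᵇ≡false (minimal z∈ ∘ inj₁)))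
    none-in-row : countBelow (row L i) j ≡ 0
    none-in-row = count≡0 _ (row L i) (λ v∈ → ≮⇒<ᵇ≡false (λ v<j →
      minimal (∈-row⁻ L v∈) (inj₂ (refl , v<j))))

lexRank-next : ∀ {L b c} → b ∈ L → c ∈ L → b <ₗ c → (∀ {z} → z ∈ L → b <ₗ z → ¬ z <ₗ c) →
               lexRank L c ≡ ParkLexGen.minδ (δLex b c) (lexRank L b) (suc (ParkLexGen.cntLe L b))
lexRank-next {L} {i' , j'} {i , j} _ _ (inj₁ i'<i) gap rewrite ≢⇒≡ᵇ≡false (<⇒≢ i'<i) =
  cong suc (trans (cong₂ _+_ same-before (rank≡0 (row L i) j none-in-row)) (+-identityʳ _))
  where
    none-in-row : countBelow (row L i) j ≡ 0
    none-in-row = count≡0 _ (row L i) (λ v∈ → ≮⇒<ᵇ≡false (λ v<j →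
      gap (∈-row⁻ L v∈) (inj₁ i'<i) (inj₂ (refl , v<j))))
    same-before : countBelow (firsts L) i ≡ ParkLexGen.cntLe L (i' , j')
    same-before = trans (count-map _ proj₁ L) (count-cong _ _ L agree)
      where
        agree : ∀ {z} → z ∈ L → (proj₁ z <ᵇ i) ≡ ParkLexGen.leᵇ z (i' , j')
        agree {a , b} z∈ with ParkLexGen.leᵇ (a , b) (i' , j') | leᵇLex-reflects (a , b) i' j'
        ... | true  | ofʸ (inj₁ a<i')       = <⇒<ᵇ≡true (<-trans a<i' i'<i)
        ... | true  | ofʸ (inj₂ (refl , _)) = <⇒<ᵇ≡true i'<i
        ... | false | ofⁿ z≮                = ≮⇒<ᵇ≡false (gap z∈ (≮ₗ-suc⇒>ₗ z≮) ∘ inj₁)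
lexRank-next {L} {i , j'} {.i , j} _ _ (inj₂ (refl , j'<j)) gap rewrite ≡⇒≡ᵇ≡true {i} refl = begin
  suc (N + rank S j)                                   ≡⟨ +-suc N (rank S j) ⟨
  N + suc (rank S j)                                   ≡⟨ cong (N +_) (rank-next S j'<j gap-in-row) ⟩
  N + ((suc (rank S j') + (j ∸ j')) ⊓ suc C)           ≡⟨ +-distribˡ-⊓ N _ _ ⟩
  (N + (suc (rank S j') + (j ∸ j'))) ⊓ (N + suc C)     ≡⟨ cong₂ _⊓_ (sym (+-assoc N _ _)) (+-suc N C) ⟩
  (N + suc (rank S j') + (j ∸ j')) ⊓ suc (N + C)       ≡⟨ cong₂ (λ t u → (t + (j ∸ j')) ⊓ suc u)
                                                             (+-suc N (rank S j')) (sym (cntLe-lex L i j')) ⟩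
  (suc (N + rank S j') + (j ∸ j')) ⊓ suc (ParkLexGen.cntLe L (i , j')) ∎
  where
    open ≡-Reasoning
    N = countBelow (firsts L) i
    S = row L i
    C = countBelow S (suc j')
    gap-in-row : ∀ {v} → v ∈ S → j' < v → ¬ v < j
    gap-in-row v∈ j'<v v<j = gap (∈-row⁻ L v∈) (inj₂ (refl , j'<v)) (inj₂ (refl , v<j))

ParkLex≡lexRank : ∀ {n} (w : Vec (ℕ × ℕ) n) → ParkLex w ≡ Vec.map (lexRank (toList w)) w
ParkLex≡lexRank =
  ParkByTable.Park≡map cmpLex δLex <ₗ-irrefl <ₗ-trans cmpLex-compares lexRank lexRank-least lexRank-next

-- Relabelling by ranks

module _ (V : List ℕ) where

  rank-reflects-< : ∀ {a b} → rank V a < rank V b → a < b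
  rank-reflects-< {a} {b} ra<rb with a <? b
  ... | yes a<b = a<b
  ... | no  a≮b = ⊥-elim (<⇒≱ ra<rb (rank-mono V (≮⇒≥ a≮b)))

  rank-reflects-≤ : ∀ {a b} → b ∈ V → rank V a ≤ rank V b → a ≤ b
  rank-reflects-≤ {a} {b} b∈ ra≤rb with a ≤? b
  ... | yes a≤b = a≤b
  ... | no  a≰b = ⊥-elim (<⇒≱ (rank-mono-< V b∈ (≰⇒> a≰b)) ra≤rb)

  countBelow-map-rank : ∀ X a → (∀ {z} → z ∈ X → z ∈ V) → countBelow (map (rank V) X) (rank V a) ≡ countBelow X a
  countBelow-map-rank X a X⊆V = trans (count-map _ (rank V) X) (count-cong _ _ X agree)
    where
      agree : ∀ {z} → z ∈ X → (rank V z <ᵇ rank V a) ≡ (z <ᵇ a)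
      agree {z} z∈ with z <? a
      ... | yes z<a = trans (<⇒<ᵇ≡true (rank-mono-< V (X⊆V z∈) z<a)) (sym (<⇒<ᵇ≡true z<a))
      ... | no  z≮a = trans (≮⇒<ᵇ≡false (z≮a ∘ rank-reflects-<)) (sym (≮⇒<ᵇ≡false z≮a))

indicator-<ᵇ-mono : ∀ y {l m} → l ≤ m → indicator (y <ᵇ l) ≤ indicator (y <ᵇ m)
indicator-<ᵇ-mono y {l} {m} l≤m with y <ᵇ l in y<l | y <ᵇ m in y<m
... | false | _     = z≤n
... | true  | true  = ≤-refl
... | true  | false with () ← trans (sym (<⇒<ᵇ≡true (<-≤-trans (<ᵇ≡true⇒< y<l) l≤m))) y<m

-- #(W ∩ [l , m)) ≤ #(V ∩ [l , m)), stated without truncated subtraction.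
countBelow-⊆-interval : ∀ {W V} → W ⊆ V → ∀ {l m} → l ≤ m →
                        countBelow W m + countBelow V l ≤ countBelow V m + countBelow W l
countBelow-⊆-interval [] _ = ≤-refl
countBelow-⊆-interval {W} {y ∷ V} (.y ∷ʳ W⊆V) {l} {m} l≤m
  rewrite count-cons (_<ᵇ l) y V | count-cons (_<ᵇ m) y V = begin
  countBelow W m + (a + countBelow V l)   ≡⟨ swap-left (countBelow W m) a (countBelow V l) ⟩
  a + (countBelow W m + countBelow V l)   ≤⟨ +-mono-≤ (indicator-<ᵇ-mono y l≤m) (countBelow-⊆-interval W⊆V l≤m) ⟩
  b + (countBelow V m + countBelow W l)   ≡⟨ +-assoc b _ _ ⟨
  b + countBelow V m + countBelow W l     ∎
  where
    open ≤-Reasoning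
    a = indicator (y <ᵇ l)
    b = indicator (y <ᵇ m)
    swap-left : ∀ x y z → x + (y + z) ≡ y + (x + z)
    swap-left = solve-∀
countBelow-⊆-interval {y ∷ W} {.y ∷ V} (refl ∷ W⊆V) {l} {m} l≤m
  rewrite count-cons (_<ᵇ l) y V | count-cons (_<ᵇ m) y V
        | count-cons (_<ᵇ l) y W | count-cons (_<ᵇ m) y W = begin
  b + countBelow W m + (a + countBelow V l)   ≡⟨ middle-four b (countBelow W m) a (countBelow V l) ⟩
  b + a + (countBelow W m + countBelow V l)   ≤⟨ +-monoʳ-≤ (b + a) (countBelow-⊆-interval W⊆V l≤m) ⟩
  b + a + (countBelow V m + countBelow W l)   ≡⟨ middle-four b (countBelow V m) a (countBelow W l) ⟨
  b + countBelow V m + (a + countBelow W l)   ∎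
  where
    open ≤-Reasoning
    a = indicator (y <ᵇ l)
    b = indicator (y <ᵇ m)
    middle-four : ∀ w x y z → w + x + (y + z) ≡ w + y + (x + z)
    middle-four = solve-∀

module _ {W V : List ℕ} (W⊆V : W ⊆ V) where

  private
    g = rank V
    W' = map g W

    W∈V : ∀ {z} → z ∈ W → z ∈ V
    W∈V = Any-resp-⊆ W⊆V

  rank-map-rank≤ : ∀ {j} → j ∈ W → rank W' (g j) ≤ rank W j
  rank-map-rank≤ {j} j∈ with rank-attained W j
  ... | k , d , d+k≡j , eq with next-letter W j∈ d k d+k≡j
  ... | l , l∈ , k≤l , l≤j , same with m≤n⇒∃[o]m+o≡n (rank-mono V l≤j) | m≤n⇒∃[o]m+o≡n l≤j
  ... | e , gl+e≡gj | e' , l+e'≡j = begin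
    rank W' (g j)                ≡⟨ cong (rank W') (trans (sym gl+e≡gj) (+-comm (g l) e)) ⟩
    rank W' (e + g l)            ≤⟨ rank-+≤countBelow W' e (g l) ⟩
    countBelow W' (g l) + e      ≡⟨ cong (_+ e) (trans (countBelow-map-rank V W l W∈V) same) ⟩
    countBelow W k + e           ≤⟨ +-monoʳ-≤ (countBelow W k) (≤-trans e≤e' e'≤d) ⟩
    countBelow W k + d           ≡⟨ eq ⟨
    rank W j                     ∎
    where
      open ≤-Reasoning
      e≤e' : e ≤ e'
      e≤e' = +-cancelˡ-≤ (g l) e e' (begin
        g l + e        ≡⟨ gl+e≡gj ⟩
        g j            ≡⟨ cong g (trans (sym l+e'≡j) (+-comm l e')) ⟩
        g (e' + l)     ≤⟨ rank-+≤ V e' l ⟩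
        e' + g l       ≡⟨ +-comm e' (g l) ⟩
        g l + e'       ∎)
      e'≤d : e' ≤ d
      e'≤d = +-cancelʳ-≤ k e' d (begin
        e' + k         ≤⟨ +-monoʳ-≤ e' k≤l ⟩
        e' + l         ≡⟨ trans (+-comm e' l) l+e'≡j ⟩
        j              ≡⟨ d+k≡j ⟨
        d + k          ∎)

  private
    bound-attained-right : ∀ {j l x m d} → l < m → d + m ≡ j → g j ≡ countBelow V m + d →
                           g l + x ≡ g j → rank W j ≤ countBelow W l + x
    bound-attained-right {j} {l} {x} {m} {d} l<m d+m≡j gj≡ gl+x≡gj = begin
      rank W j                 ≡⟨ cong (rank W) (sym d+m≡j) ⟩
      rank W (d + m)           ≤⟨ rank-+≤countBelow W d m ⟩
      countBelow W m + d       ≤⟨ +-cancelʳ-≤ (countBelow V l) _ _ (begin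
        countBelow W m + d + countBelow V l   ≡⟨ shuffle (countBelow W m) d (countBelow V l) ⟩
        countBelow W m + countBelow V l + d   ≤⟨ +-monoˡ-≤ d (countBelow-⊆-interval W⊆V (<⇒≤ l<m)) ⟩
        countBelow V m + countBelow W l + d   ≡⟨ shuffle (countBelow V m) (countBelow W l) d ⟩
        countBelow V m + d + countBelow W l   ≡⟨ cong (_+ countBelow W l) (trans (sym gj≡) (sym gl+x≡gj)) ⟩
        g l + x + countBelow W l              ≤⟨ +-monoˡ-≤ (countBelow W l) (+-monoˡ-≤ x (rank≤countBelow V l)) ⟩
        countBelow V l + x + countBelow W l   ≡⟨ reverse (countBelow V l) x (countBelow W l) ⟩
        countBelow W l + x + countBelow V l   ∎) ⟩
      countBelow W l + x       ∎
      where
        open ≤-Reasoning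
        shuffle : ∀ a b c → a + b + c ≡ a + c + b
        shuffle = solve-∀
        reverse : ∀ a b c → a + b + c ≡ c + b + a
        reverse = solve-∀

    bound-attained-left : ∀ {j l x m d} → m ≤ l → l ≤ j → d + m ≡ j → g j ≡ countBelow V m + d →
                          g l + x ≡ g j → rank W j ≤ countBelow W l + x
    bound-attained-left {j} {l} {x} {m} {d} m≤l l≤j d+m≡j gj≡ gl+x≡gj
      with m≤n⇒∃[o]m+o≡n m≤l | m≤n⇒∃[o]m+o≡n l≤j
    ... | a , refl | b , refl = begin
      rank W (m + a + b)       ≡⟨ cong (rank W) (+-comm (m + a) b) ⟩
      rank W (b + (m + a))     ≤⟨ rank-+≤countBelow W b (m + a) ⟩
      countBelow W (m + a) + b ≤⟨ +-monoʳ-≤ (countBelow W (m + a)) b≤x ⟩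
      countBelow W (m + a) + x ∎
      where
        open ≤-Reasoning
        d≡b+a : d ≡ b + a
        d≡b+a = +-cancelʳ-≡ m d (b + a) (trans d+m≡j (rotate m a b))
          where
            rotate : ∀ m a b → m + a + b ≡ b + a + m
            rotate = solve-∀
        b≤x : b ≤ x
        b≤x = +-cancelˡ-≤ (countBelow V m + a) b x (begin
          countBelow V m + a + b     ≡⟨ regroup (countBelow V m) a b ⟩
          countBelow V m + (b + a)   ≡⟨ cong (countBelow V m +_) d≡b+a ⟨
          countBelow V m + d         ≡⟨ trans (sym gj≡) (sym gl+x≡gj) ⟩
          g (m + a) + x              ≤⟨ +-monoˡ-≤ x (subst (λ t → g t ≤ countBelow V m + a)
                                           (+-comm a m) (rank-+≤countBelow V a m)) ⟩
          countBelow V m + a + x     ∎)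
          where
            regroup : ∀ c a b → c + a + b ≡ c + (b + a)
            regroup = solve-∀

  -- Split on where the minimum defining rank V j is attained: at or left of l,
  -- the gap x is at least j ∸ l; right of l, compare the interval counts of W and V.
  rank≤countBelow+gap : ∀ {j l x} → l ≤ j → g l + x ≡ g j → rank W j ≤ countBelow W l + x
  rank≤countBelow+gap {j} {l} l≤j gl+x≡gj with rank-attained V j
  ... | m , d , d+m≡j , gj≡ with m ≤? l
  ... | yes m≤l = bound-attained-left m≤l l≤j d+m≡j gj≡ gl+x≡gj
  ... | no  m≰l = bound-attained-right (≰⇒> m≰l) d+m≡j gj≡ gl+x≡gj

  rank≤rank-map-rank : ∀ {j} → j ∈ W → rank W j ≤ rank W' (g j)
  rank≤rank-map-rank {j} j∈ with rank-attained W' (g j)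
  ... | k , d , d+k≡gj , eq with next-letter W' (∈-map⁺ g j∈) d k d+k≡gj
  ... | _ , gl∈ , k≤gl , gl≤gj , same with ∈-map⁻ g gl∈
  ... | l , l∈ , refl with m≤n⇒∃[o]m+o≡n gl≤gj
  ... | x , gl+x≡gj = begin
    rank W j                     ≤⟨ rank≤countBelow+gap {l = l} (rank-reflects-≤ V (W∈V j∈) gl≤gj) gl+x≡gj ⟩
    countBelow W l + x           ≤⟨ +-monoʳ-≤ (countBelow W l) x≤d ⟩
    countBelow W l + d           ≡⟨ cong (_+ d) (trans (sym (countBelow-map-rank V W l W∈V)) same) ⟩
    countBelow W' k + d          ≡⟨ eq ⟨
    rank W' (g j)                ∎
    where
      open ≤-Reasoning
      x≤d : x ≤ d
      x≤d = +-cancelˡ-≤ k x d (begin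
        k + x          ≤⟨ +-monoˡ-≤ x k≤gl ⟩
        g l + x        ≡⟨ trans gl+x≡gj (sym d+k≡gj) ⟩
        d + k          ≡⟨ +-comm d k ⟩
        k + d          ∎)

  rank-map-rank : ∀ {j} → j ∈ W → rank (map (rank V) W) (rank V j) ≡ rank W j
  rank-map-rank j∈ = ≤-antisym (rank-map-rank≤ j∈) (rank≤rank-map-rank j∈)

seconds : List (ℕ × ℕ) → List ℕ
seconds = map proj₂

row-⊆-seconds : ∀ L i → row L i ⊆ seconds L
row-⊆-seconds L i = map⁺ proj₂ (filter-⊆ (T? ∘ λ z → proj₁ z ≡ᵇ i) L)

row-map : ∀ (f g : ℕ → ℕ) L {i} → (∀ {a} → a ∈ firsts L → f a ≡ f i → a ≡ i) →
          row (map (Product.map f g) L) (f i) ≡ map g (row L i)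
row-map f g []            _   = refl
row-map f g ((a , b) ∷ L) {i} inj with a ≟ i
... | yes refl rewrite ≡⇒≡ᵇ≡true {f a} refl | ≡⇒≡ᵇ≡true {a} refl =
  cong (g b ∷_) (row-map f g L (inj ∘ there))
... | no  a≢i rewrite ≢⇒≡ᵇ≡false (a≢i ∘ inj (here refl)) | ≢⇒≡ᵇ≡false a≢i = row-map f g L (inj ∘ there)

countBelow-map-suc : ∀ xs k → countBelow (map suc xs) (suc k) ≡ countBelow xs k
countBelow-map-suc xs k = count-map _ suc xs

rank-map-suc : ∀ xs k → rank (map suc xs) (suc k) ≡ rank xs k
rank-map-suc xs zero    = rank≡0 (map suc xs) 1 (trans (countBelow-map-suc xs 0) (countBelow-zero xs))
rank-map-suc xs (suc k) = cong₂ (λ r c → suc r ⊓ c) (rank-map-suc xs k) (countBelow-map-suc xs (suc k))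

parkValue-injective : ∀ xs {a b} → a ∈ xs → b ∈ xs → parkValue xs a ≡ parkValue xs b → a ≡ b
parkValue-injective xs {a} {b} a∈ b∈ same with <-cmp a b
... | tri< a<b _ _ = ⊥-elim (<-irrefl (suc-injective same) (rank-mono-< xs a∈ a<b))
... | tri≈ _ a≡b _ = a≡b
... | tri> _ _ b<a = ⊥-elim (<-irrefl (sym (suc-injective same)) (rank-mono-< xs b∈ b<a))

countBelow-map-parkValue : ∀ V X a → (∀ {z} → z ∈ X → z ∈ V) →
                           countBelow (map (parkValue V) X) (parkValue V a) ≡ countBelow X a
countBelow-map-parkValue V X a X⊆V = begin
  countBelow (map (parkValue V) X) (parkValue V a)   ≡⟨ count-map _ (parkValue V) X ⟩
  count (λ z → rank V z <ᵇ rank V a) X               ≡⟨ count-map _ (rank V) X ⟨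
  countBelow (map (rank V) X) (rank V a)             ≡⟨ countBelow-map-rank V X a X⊆V ⟩
  countBelow X a                                     ∎
  where open ≡-Reasoning

rank-map-parkValue : ∀ {W V} → W ⊆ V → ∀ {j} → j ∈ W → rank (map (parkValue V) W) (parkValue V j) ≡ rank W j
rank-map-parkValue {W} {V} W⊆V {j} j∈ = begin
  rank (map (parkValue V) W) (parkValue V j)     ≡⟨ cong (λ xs → rank xs (parkValue V j)) (List.map-∘ W) ⟩
  rank (map suc (map (rank V) W)) (suc (rank V j)) ≡⟨ rank-map-suc (map (rank V) W) (rank V j) ⟩
  rank (map (rank V) W) (rank V j)               ≡⟨ rank-map-rank W⊆V j∈ ⟩
  rank W j                                       ∎
  where open ≡-Reasoning

module _ (L : List (ℕ × ℕ)) where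

  relabel : ℕ × ℕ → ℕ × ℕ
  relabel = Product.map (parkValue (firsts L)) (parkValue (seconds L))

  lexRank-relabel : ∀ {x} → x ∈ L → lexRank (map relabel L) (relabel x) ≡ lexRank L x
  lexRank-relabel {i , j} x∈ = cong suc (cong₂ _+_ same-before same-in-row)
    where
      open ≡-Reasoning
      U = firsts L
      f = parkValue U
      g = parkValue (seconds L)
      i∈ : i ∈ U
      i∈ = ∈-map⁺ proj₁ x∈
      firsts-relabel : firsts (map relabel L) ≡ map f U
      firsts-relabel = trans (sym (List.map-∘ L)) (List.map-∘ L)
      same-before : countBelow (firsts (map relabel L)) (f i) ≡ countBelow U i
      same-before = trans (cong (λ xs → countBelow xs (f i)) firsts-relabel) (countBelow-map-parkValue U U i id)
      same-in-row : rank (row (map relabel L) (f i)) (g j) ≡ rank (row L i) j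
      same-in-row = begin
        rank (row (map relabel L) (f i)) (g j)
          ≡⟨ cong (λ xs → rank xs (g j)) (row-map f g L (λ a∈ → parkValue-injective U a∈ i∈)) ⟩
        rank (map g (row L i)) (g j)            ≡⟨ rank-map-parkValue (row-⊆-seconds L i) (∈-row⁺ L x∈) ⟩
        rank (row L i) j                        ∎

firsts-toList-⊗ : ∀ {n} (u v : Vec ℕ n) → firsts (toList (u ⊗ v)) ≡ toList u
firsts-toList-⊗ Vec.[]       Vec.[]       = refl
firsts-toList-⊗ (x Vec.∷ u) (y Vec.∷ v) = cong (x ∷_) (firsts-toList-⊗ u v)

seconds-toList-⊗ : ∀ {n} (u v : Vec ℕ n) → seconds (toList (u ⊗ v)) ≡ toList v
seconds-toList-⊗ Vec.[]       Vec.[]       = refl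
seconds-toList-⊗ (x Vec.∷ u) (y Vec.∷ v) = cong (y ∷_) (seconds-toList-⊗ u v)

ParkLex-Park⊗Park : ∀ {n} (u v : Vec ℕ n) → ParkLex (Park u ⊗ Park v) ≡ ParkLex (u ⊗ v)
ParkLex-Park⊗Park u v = begin
  ParkLex (Park u ⊗ Park v)
    ≡⟨ cong₂ (λ a b → ParkLex (a ⊗ b)) (Park≡parkValue u) (Park≡parkValue v) ⟩
  ParkLex (Vec.map (parkValue (toList u)) u ⊗ Vec.map (parkValue (toList v)) v)
    ≡⟨ cong₂ (λ U V → ParkLex (Vec.map (parkValue U) u ⊗ Vec.map (parkValue V) v))
             (sym (firsts-toList-⊗ u v)) (sym (seconds-toList-⊗ u v)) ⟩
  ParkLex (Vec.map (parkValue (firsts L)) u ⊗ Vec.map (parkValue (seconds L)) v)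
    ≡⟨ cong ParkLex (Vec.map-zip _ _ u v) ⟨
  ParkLex (Vec.map (relabel L) (u ⊗ v))
    ≡⟨ ParkLex≡lexRank (Vec.map (relabel L) (u ⊗ v)) ⟩
  Vec.map (lexRank (toList (Vec.map (relabel L) (u ⊗ v)))) (Vec.map (relabel L) (u ⊗ v))
    ≡⟨ cong (λ L' → Vec.map (lexRank L') (Vec.map (relabel L) (u ⊗ v))) (Vec.toList-map (relabel L) (u ⊗ v)) ⟩
  Vec.map (lexRank (map (relabel L) L)) (Vec.map (relabel L) (u ⊗ v))
    ≡⟨ Vec.map-∘ _ _ (u ⊗ v) ⟨
  Vec.map (lexRank (map (relabel L) L) ∘ relabel L) (u ⊗ v)
    ≡⟨ Vec-map-cong-∈ (u ⊗ v) (lexRank-relabel L) ⟩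
  Vec.map (lexRank L) (u ⊗ v)
    ≡⟨ ParkLex≡lexRank (u ⊗ v) ⟨
  ParkLex (u ⊗ v)
    ∎
  where
    open ≡-Reasoning
    L = toList (u ⊗ v)

-- Encoding pairs as integers

encode : ℕ → ℕ × ℕ → ℕ
encode K (a , b) = a ℕ.* K + b

module _ (K : ℕ) where

  encode<row : ∀ {a b i} → b < K → a < i → encode K (a , b) < i ℕ.* K
  encode<row {a} {b} {i} b<K a<i = begin-strict
    a ℕ.* K + b   <⟨ +-monoʳ-< (a ℕ.* K) b<K ⟩
    a ℕ.* K + K   ≡⟨ +-comm (a ℕ.* K) K ⟩
    suc a ℕ.* K   ≤⟨ *-monoˡ-≤ K a<i ⟩
    i ℕ.* K       ∎
    where open ≤-Reasoning

  encode-reflects-<ₗ : ∀ {x y} → proj₂ x < K → proj₂ y < K → Reflects (x <ₗ y) (encode K x <ᵇ encode K y)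
  encode-reflects-<ₗ {a , b} {i , j} b<K j<K with <-cmp a i
  ... | tri< a<i _ _ rewrite <⇒<ᵇ≡true (<-≤-trans (encode<row b<K a<i) (m≤m+n (i ℕ.* K) j)) = ofʸ (inj₁ a<i)
  ... | tri> _ _ i<a rewrite ≮⇒<ᵇ≡false (<⇒≯ (<-≤-trans (encode<row j<K i<a) (m≤m+n (a ℕ.* K) b))) =
    ofⁿ λ { (inj₁ a<i) → <⇒≯ a<i i<a ; (inj₂ (refl , _)) → <-irrefl refl i<a }
  ... | tri≈ _ refl _ with b <? j
  ...   | yes b<j rewrite <⇒<ᵇ≡true (+-monoʳ-< (a ℕ.* K) b<j) = ofʸ (inj₂ (refl , b<j))
  ...   | no  b≮j rewrite ≮⇒<ᵇ≡false (≤⇒≯ (+-monoʳ-≤ (a ℕ.* K) (≮⇒≥ b≮j))) =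
    ofⁿ λ { (inj₁ a<a) → <-irrefl refl a<a ; (inj₂ (_ , b<j)) → b≮j b<j }

module _ (K : ℕ) (L : List (ℕ × ℕ)) (small : ∀ {z} → z ∈ L → proj₂ z + length L < K) where

  private
    X = map (encode K) L
    n = length L

    second<K : ∀ {z} → z ∈ L → proj₂ z < K
    second<K z∈ = ≤-<-trans (m≤m+n _ n) (small z∈)

  countBelow-encode : ∀ i j → j < K → countBelow X (i ℕ.* K + j) ≡ countBelow (firsts L) i + countBelow (row L i) j
  countBelow-encode i j j<K = trans (count-map _ (encode K) L)
    (count-reflecting-<ₗ _ L i j (λ z∈ → encode-reflects-<ₗ K (second<K z∈) j<K))

  encode-far-below-row : ∀ {z} i → z ∈ L → encode K z < i ℕ.* K → encode K z + n < i ℕ.* K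
  encode-far-below-row {a , b} i z∈ z<iK with a <? i
  ... | no  a≮i = ⊥-elim (<⇒≱ z<iK (≤-trans (*-monoˡ-≤ K (≮⇒≥ a≮i)) (m≤m+n (a ℕ.* K) b)))
  ... | yes a<i = begin-strict
    a ℕ.* K + b + n     ≡⟨ +-assoc (a ℕ.* K) b n ⟩
    a ℕ.* K + (b + n)   <⟨ encode<row K (small z∈) a<i ⟩
    i ℕ.* K             ∎
    where open ≤-Reasoning

  -- The minimum defining rank X (i·K) is attained at i·K itself: encoded letters below
  -- row i stop n short of i·K, so a window [k , i·K) shorter than n holds no letter,
  -- and a longer one costs at least n ≥ countBelow X (i·K).
  rank-encode-rowStart : ∀ i → rank X (i ℕ.* K) ≡ countBelow X (i ℕ.* K)
  rank-encode-rowStart i with rank-attained X (i ℕ.* K)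
  ... | k , d , d+k≡iK , rank≡ =
    ≤-antisym (rank≤countBelow X (i ℕ.* K)) (subst (countBelow X (i ℕ.* K) ≤_) (sym rank≡) bound)
    where
      bound : countBelow X (i ℕ.* K) ≤ countBelow X k + d
      bound with n ≤? d
      ... | yes n≤d = begin
        countBelow X (i ℕ.* K)    ≤⟨ count≤length _ X ⟩
        length X                  ≡⟨ List.length-map (encode K) L ⟩
        n                         ≤⟨ n≤d ⟩
        d                         ≤⟨ m≤n+m d _ ⟩
        countBelow X k + d        ∎
        where open ≤-Reasoning
      ... | no  n≰d = ≤-trans (count-mono _ _ X below-k) (m≤m+n _ d)
        where
          below-k : ∀ {x} → x ∈ X → (x <ᵇ i ℕ.* K) ≡ true → (x <ᵇ k) ≡ true
          below-k x∈ x<iK with ∈-map⁻ (encode K) x∈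
          ... | z , z∈ , refl = <⇒<ᵇ≡true (+-cancelʳ-< d _ k (begin-strict
            encode K z + d     <⟨ +-monoʳ-< (encode K z) (≰⇒> n≰d) ⟩
            encode K z + n     <⟨ encode-far-below-row i z∈ (<ᵇ≡true⇒< x<iK) ⟩
            i ℕ.* K            ≡⟨ trans (sym d+k≡iK) (+-comm d k) ⟩
            k + d              ∎))
            where open ≤-Reasoning

  rank-encode : ∀ i j → j < K → rank X (i ℕ.* K + j) ≡ countBelow (firsts L) i + rank (row L i) j
  rank-encode i zero 0<K = begin
    rank X (i ℕ.* K + 0)                           ≡⟨ cong (rank X) (+-identityʳ (i ℕ.* K)) ⟩
    rank X (i ℕ.* K)                               ≡⟨ rank-encode-rowStart i ⟩
    countBelow X (i ℕ.* K)                         ≡⟨ cong (countBelow X) (+-identityʳ (i ℕ.* K)) ⟨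
    countBelow X (i ℕ.* K + 0)                     ≡⟨ countBelow-encode i 0 0<K ⟩
    countBelow (firsts L) i + countBelow (row L i) 0 ≡⟨ cong (countBelow (firsts L) i +_) (countBelow-zero (row L i)) ⟩
    countBelow (firsts L) i + 0                    ∎
    where open ≡-Reasoning
  rank-encode i (suc j) j<K = begin
    rank X (i ℕ.* K + suc j)                         ≡⟨ cong (rank X) (+-suc (i ℕ.* K) j) ⟩
    suc (rank X (i ℕ.* K + j)) ⊓ countBelow X (suc (i ℕ.* K + j))
      ≡⟨ cong₂ (λ r c → suc r ⊓ c) (rank-encode i j (<-trans (n<1+n j) j<K))
               (trans (cong (countBelow X) (sym (+-suc (i ℕ.* K) j))) (countBelow-encode i (suc j) j<K)) ⟩
    suc (N + rank S j) ⊓ (N + countBelow S (suc j))  ≡⟨ cong (_⊓ (N + countBelow S (suc j))) (+-suc N (rank S j)) ⟨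
    (N + suc (rank S j)) ⊓ (N + countBelow S (suc j)) ≡⟨ +-distribˡ-⊓ N _ _ ⟨
    N + rank S (suc j)                               ∎
    where
      open ≡-Reasoning
      N = countBelow (firsts L) i
      S = row L i

  lexRank≡parkValue∘encode : ∀ {x} → x ∈ L → lexRank L x ≡ parkValue X (encode K x)
  lexRank≡parkValue∘encode {i , j} x∈ = cong suc (sym (rank-encode i j (second<K x∈)))

ParkLex≡Park∘encode : ∀ {n} K (w : Vec (ℕ × ℕ) n) → (∀ {z} → z ∈ toList w → proj₂ z + n < K) →
                      ParkLex w ≡ Park (Vec.map (encode K) w)
ParkLex≡Park∘encode {n} K w small = begin
  ParkLex w                                              ≡⟨ ParkLex≡lexRank w ⟩
  Vec.map (lexRank L) w                                  ≡⟨ Vec-map-cong-∈ w (lexRank≡parkValue∘encode K L small') ⟩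
  Vec.map (parkValue (map (encode K) L) ∘ encode K) w     ≡⟨ Vec.map-∘ _ _ w ⟩
  Vec.map (parkValue (map (encode K) L)) (Vec.map (encode K) w)
    ≡⟨ cong (λ xs → Vec.map (parkValue xs) (Vec.map (encode K) w)) (Vec.toList-map (encode K) w) ⟨
  Vec.map (parkValue (toList (Vec.map (encode K) w))) (Vec.map (encode K) w) ≡⟨ Park≡parkValue (Vec.map (encode K) w) ⟨
  Park (Vec.map (encode K) w)                            ∎
  where
    open ≡-Reasoning
    L = toList w
    small' : ∀ {z} → z ∈ L → proj₂ z + length L < K
    small' z∈ = subst (λ m → _ + m < K) (sym (Vec.length-toList w)) (small z∈)

-- Parking functions

count-↭ : ∀ {A : Set} (p : A → Bool) {xs ys} → xs ↭ ys → count p xs ≡ count p ys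
count-↭ p xs↭ys = ↭-length (filter-↭ (T? ∘ p) xs↭ys)

insertℕ-↭ : ∀ x ys → insertℕ x ys ↭ x ∷ ys
insertℕ-↭ x []       = ↭-refl
insertℕ-↭ x (y ∷ ys) with x ≤ᵇ y
... | true  = ↭-refl
... | false = ↭-trans (prep y (insertℕ-↭ x ys)) (swap y x ↭-refl)

sortℕ-↭ : ∀ xs → sortℕ xs ↭ xs
sortℕ-↭ []       = ↭-refl
sortℕ-↭ (x ∷ xs) = ↭-trans (insertℕ-↭ x (sortℕ xs)) (prep x (sortℕ-↭ xs))

insertℕ-All : ∀ {P : ℕ → Set} {x} ys → P x → All P ys → All P (insertℕ x ys)
insertℕ-All []                px []         = px ∷ []
insertℕ-All {x = x} (y ∷ ys) px (py ∷ pys) with x ≤ᵇ y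
... | true  = px ∷ py ∷ pys
... | false = py ∷ insertℕ-All ys px pys

insertℕ-sorted : ∀ x ys → AllPairs _≤_ ys → AllPairs _≤_ (insertℕ x ys)
insertℕ-sorted x []       []               = [] ∷ []
insertℕ-sorted x (y ∷ ys) (y≤ys ∷ sorted) with x ≤ᵇ y in x≤ᵇy
... | true  = (x≤y ∷ All.map (≤-trans x≤y) y≤ys) ∷ y≤ys ∷ sorted
  where x≤y = ≤ᵇ⇒≤ x y (subst T (sym x≤ᵇy) tt)
... | false = insertℕ-All ys y≤x y≤ys ∷ insertℕ-sorted x ys sorted
  where y≤x = ≰⇒≥ (λ x≤y → subst T x≤ᵇy (≤⇒≤ᵇ x≤y))

sortℕ-sorted : ∀ xs → AllPairs _≤_ (sortℕ xs)
sortℕ-sorted []       = []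
sortℕ-sorted (x ∷ xs) = insertℕ-sorted x (sortℕ xs) (sortℕ-sorted xs)

module _ (i x : ℕ) (xs : List ℕ) where

  pfCheck-unfold : T (pfCheck i (x ∷ xs)) → T (1 ≤ᵇ x) × T (x ≤ᵇ i) × T (pfCheck (suc i) xs)
  pfCheck-unfold t with Equivalence.to (T-∧ {1 ≤ᵇ x}) t
  ... | 1≤x , rest = 1≤x , Equivalence.to (T-∧ {x ≤ᵇ i}) rest

  pfCheck-head : T (pfCheck i (x ∷ xs)) → 1 ≤ x × x ≤ i
  pfCheck-head t with pfCheck-unfold t
  ... | 1≤x , x≤i , _ = ≤ᵇ⇒≤ 1 x 1≤x , ≤ᵇ⇒≤ x i x≤i

  pfCheck-tail : T (pfCheck i (x ∷ xs)) → T (pfCheck (suc i) xs)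
  pfCheck-tail = proj₂ ∘ proj₂ ∘ pfCheck-unfold

  pfCheck-cons : 1 ≤ x → x ≤ i → T (pfCheck (suc i) xs) → T (pfCheck i (x ∷ xs))
  pfCheck-cons 1≤x x≤i t = Equivalence.from T-∧ (≤⇒≤ᵇ 1≤x , Equivalence.from T-∧ (≤⇒≤ᵇ x≤i , t))

pfCheck-bounds : ∀ i S → T (pfCheck i S) → ∀ {y} → y ∈ S → 1 ≤ y × y < i + length S
pfCheck-bounds i (x ∷ xs) t (here refl) with pfCheck-head i x xs t
... | 1≤x , x≤i = 1≤x , ≤-trans (s≤s (≤-trans x≤i (m≤m+n i (length xs)))) (≤-reflexive (sym (+-suc i (length xs))))
pfCheck-bounds i (x ∷ xs) t {y} (there y∈) with pfCheck-bounds (suc i) xs (pfCheck-tail i x xs t) y∈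
... | 1≤y , y< = 1≤y , subst (y <_) (sym (+-suc i (length xs))) y<

pfCheck-count : ∀ i S → T (pfCheck i S) → ∀ m → m ≤ length S → m ≤ countBelow S (i + m)
pfCheck-count i S        t zero    _         = z≤n
pfCheck-count i (x ∷ xs) t (suc m) (s≤s m≤) = begin
  suc m                           ≤⟨ s≤s (pfCheck-count (suc i) xs (pfCheck-tail i x xs t) m m≤) ⟩
  suc (countBelow xs (suc i + m)) ≡⟨ cong (suc ∘ countBelow xs) (sym (+-suc i m)) ⟩
  suc (countBelow xs (i + suc m)) ≡⟨ count-accept _ xs (<⇒<ᵇ≡true x<) ⟨
  countBelow (x ∷ xs) (i + suc m) ∎
  where
    open ≤-Reasoning
    x< : x < i + suc m
    x< = ≤-trans (s≤s (≤-trans (proj₂ (pfCheck-head i x xs t)) (m≤m+n i m))) (≤-reflexive (sym (+-suc i m)))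

pfCheck-complete : ∀ i S → AllPairs _≤_ S → (∀ {y} → y ∈ S → 1 ≤ y × y ≤ i + countBelow S y) → T (pfCheck i S)
pfCheck-complete i []       _                  _      = tt
pfCheck-complete i (x ∷ xs) (x≤xs ∷ sorted) bounds =
  pfCheck-cons i x xs (proj₁ (bounds (here refl))) x≤i (pfCheck-complete (suc i) xs sorted bounds')
  where
    nothing-below-x : countBelow (x ∷ xs) x ≡ 0
    nothing-below-x = count≡0 _ (x ∷ xs) λ
      { (here refl) → ≮⇒<ᵇ≡false {x} (<-irrefl refl)
      ; (there z∈)  → ≮⇒<ᵇ≡false (≤⇒≯ (All.lookup x≤xs z∈)) }
    x≤i : x ≤ i
    x≤i = subst (x ≤_) (trans (cong (i +_) nothing-below-x) (+-identityʳ i)) (proj₂ (bounds (here refl)))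
    bounds' : ∀ {y} → y ∈ xs → 1 ≤ y × y ≤ suc i + countBelow xs y
    bounds' {y} y∈ = proj₁ (bounds (there y∈)) , (begin
      y                                       ≤⟨ proj₂ (bounds (there y∈)) ⟩
      i + countBelow (x ∷ xs) y               ≡⟨ cong (i +_) (count-cons _ x xs) ⟩
      i + (indicator (x <ᵇ y) + countBelow xs y) ≤⟨ +-monoʳ-≤ i (+-monoˡ-≤ _ (indicator≤1 (x <ᵇ y))) ⟩
      i + suc (countBelow xs y)               ≡⟨ +-suc i _ ⟩
      suc i + countBelow xs y                 ∎)
      where
        open ≤-Reasoning
        indicator≤1 : ∀ b → indicator b ≤ 1
        indicator≤1 true  = ≤-refl
        indicator≤1 false = z≤n

module _ {n} (a : Vec ℕ n) where

  private
    A = toList a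

    length-sort : length (sortℕ A) ≡ n
    length-sort = trans (↭-length (sortℕ-↭ A)) (Vec.length-toList a)

  isPF-bounds : T (isPF a) → ∀ {y} → y ∈ A → 1 ≤ y × y ≤ n
  isPF-bounds pf {y} y∈ with pfCheck-bounds 1 (sortℕ A) pf (∈-resp-↭ (↭-sym (sortℕ-↭ A)) y∈)
  ... | 1≤y , y< = 1≤y , ≤-pred (subst (λ k → y < suc k) length-sort y<)

  isPF-count : T (isPF a) → ∀ m → m ≤ n → m ≤ countBelow A (suc m)
  isPF-count pf m m≤n = subst (m ≤_) (count-↭ _ (sortℕ-↭ A))
    (pfCheck-count 1 (sortℕ A) pf m (subst (m ≤_) (sym length-sort) m≤n))

  isPF-complete : (∀ {y} → y ∈ A → 1 ≤ y × y ≤ suc (countBelow A y)) → T (isPF a)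
  isPF-complete bounds = pfCheck-complete 1 (sortℕ A) (sortℕ-sorted A) λ y∈ →
    let 1≤y , y≤ = bounds (∈-resp-↭ (sortℕ-↭ A) y∈)
    in 1≤y , subst (λ c → _ ≤ suc c) (sym (count-↭ _ (sortℕ-↭ A))) y≤

  -- On a parking function, rank x = x ∸ 1: countBelow A 1 = 0 bounds it above,
  -- and the parking condition m ≤ countBelow A (suc m) bounds it below.
  parkValue-pf : T (isPF a) → ∀ {x} → x ∈ A → parkValue A x ≡ x
  parkValue-pf pf {suc x} x∈ = cong suc (≤-antisym upper (lower (suc x) (proj₂ (isPF-bounds pf x∈))))
    where
      none-below-1 : countBelow A 1 ≡ 0
      none-below-1 = count≡0 _ A (λ z∈ → ≮⇒<ᵇ≡false (<⇒≱ (proj₁ (isPF-bounds pf z∈)) ∘ ≤-pred))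
      upper : rank A (suc x) ≤ x
      upper = subst₂ (λ k c → rank A k ≤ c) (+-comm x 1) (cong (_+ x) none-below-1) (rank-+≤countBelow A x 1)
      lower : ∀ j → j ≤ n → pred j ≤ rank A j
      lower zero    _   = z≤n
      lower (suc j) j<n = ⊓-glb (≤-trans (m≤n+m∸n j 1) (s≤s (lower j (<⇒≤ j<n)))) (isPF-count pf j (<⇒≤ j<n))
  parkValue-pf pf {zero} x∈ with () ← proj₁ (isPF-bounds pf x∈)

  Park-pf : T (isPF a) → Park a ≡ a
  Park-pf pf = trans (Park≡parkValue a) (trans (Vec-map-cong-∈ a (parkValue-pf pf)) (Vec.map-id a))

Park-isPF : ∀ {n} (w : Vec ℕ n) → T (isPF (Park w))
Park-isPF w = subst (T ∘ isPF) (sym (Park≡parkValue w)) (isPF-complete (Vec.map f w) bounds)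
  where
    W = toList w
    f = parkValue W
    bounds : ∀ {y} → y ∈ toList (Vec.map f w) → 1 ≤ y × y ≤ suc (countBelow (toList (Vec.map f w)) y)
    bounds y∈ with ∈-map⁻ f (subst (_ ∈_) (Vec.toList-map f w) y∈)
    ... | z , _ , refl = s≤s z≤n , s≤s (begin
      rank W z                                 ≤⟨ rank≤countBelow W z ⟩
      countBelow W z                           ≡⟨ countBelow-map-parkValue W W z id ⟨
      countBelow (map f W) (f z)               ≡⟨ cong (λ xs → countBelow xs (f z)) (Vec.toList-map f w) ⟨
      countBelow (toList (Vec.map f w)) (f z)  ∎)
      where open ≤-Reasoning

∈-toList-⊗ : ∀ {n} (u v : Vec ℕ n) {x y} → (x , y) ∈ toList (u ⊗ v) → x ∈ toList u × y ∈ toList v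
∈-toList-⊗ u v xy∈ = subst (_ ∈_) (firsts-toList-⊗ u v) (∈-map⁺ proj₁ xy∈)
                   , subst (_ ∈_) (seconds-toList-⊗ u v) (∈-map⁺ proj₂ xy∈)

ParkLex⊗≡Park∘encode : ∀ {n} K (u v : Vec ℕ n) → (∀ {y} → y ∈ toList v → y + n < K) →
                       ParkLex (u ⊗ v) ≡ Park (Vec.map (encode K) (u ⊗ v))
ParkLex⊗≡Park∘encode K u v small = ParkLex≡Park∘encode K (u ⊗ v) (small ∘ proj₂ ∘ ∈-toList-⊗ u v)

encode-assoc : ∀ {n} K (a b c : Vec ℕ n) →
               Vec.map (encode K) (Vec.map (encode K) (a ⊗ b) ⊗ c)
                 ≡ Vec.map (encode (K ℕ.* K)) (a ⊗ Vec.map (encode K) (b ⊗ c))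
encode-assoc K Vec.[]       Vec.[]       Vec.[]       = refl
encode-assoc K (x Vec.∷ a) (y Vec.∷ b) (z Vec.∷ c) = cong₂ Vec._∷_ (horner x y z K) (encode-assoc K a b c)
  where
    horner : ∀ x y z K → (x ℕ.* K + y) ℕ.* K + z ≡ x ℕ.* (K ℕ.* K) + (y ℕ.* K + z)
    horner = solve-∀

isPF-letter+n<1+2n : ∀ {n} {v : Vec ℕ n} → T (isPF v) → ∀ {y} → y ∈ toList v → y + n < suc (n + n)
isPF-letter+n<1+2n {n} pf y∈ = s≤s (+-monoˡ-≤ n (proj₂ (isPF-bounds _ pf y∈)))

ParkLex-isPF : ∀ {n} (a b : Vec ℕ n) → T (isPF b) → T (isPF (ParkLex (a ⊗ b)))
ParkLex-isPF {n} a b pf-b = subst (T ∘ isPF) (sym (ParkLex⊗≡Park∘encode (suc (n + n)) a b (isPF-letter+n<1+2n pf-b)))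
                              (Park-isPF (Vec.map (encode (suc (n + n))) (a ⊗ b)))

module _ {n} (a b c : Vec ℕ n) (pf-a : T (isPF a)) (pf-b : T (isPF b)) (pf-c : T (isPF c)) where

  private
    K = suc (n + n)

    small : ∀ {v : Vec ℕ n} → T (isPF v) → ∀ {y} → y ∈ toList v → y + n < K
    small = isPF-letter+n<1+2n

    ab = Vec.map (encode K) (a ⊗ b)
    bc = Vec.map (encode K) (b ⊗ c)

    small-bc : ∀ {y} → y ∈ toList bc → y + n < K ℕ.* K
    small-bc y∈ with ∈-map⁻ (encode K) (subst (_ ∈_) (Vec.toList-map (encode K) (b ⊗ c)) y∈)
    ... | (y₁ , y₂) , y₁₂∈ , refl = begin-strict
      y₁ ℕ.* K + y₂ + n    ≤⟨ +-monoˡ-≤ n (+-mono-≤ (*-monoˡ-≤ K y₁≤n) y₂≤n) ⟩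
      n ℕ.* K + n + n      ≡⟨ +-assoc (n ℕ.* K) n n ⟩
      n ℕ.* K + (n + n)    <⟨ +-monoʳ-< (n ℕ.* K) (n<1+n (n + n)) ⟩
      n ℕ.* K + K          ≡⟨ +-comm (n ℕ.* K) K ⟩
      suc n ℕ.* K          ≤⟨ *-monoˡ-≤ K (s≤s (m≤m+n n n)) ⟩
      K ℕ.* K              ∎
      where
        open ≤-Reasoning
        y₁≤n = proj₂ (isPF-bounds b pf-b (proj₁ (∈-toList-⊗ b c y₁₂∈)))
        y₂≤n = proj₂ (isPF-bounds c pf-c (proj₂ (∈-toList-⊗ b c y₁₂∈)))

  -- Both sides are the parkization of the integer word a·K² + b·K + c.
  ParkLex-assoc : ParkLex (ParkLex (a ⊗ b) ⊗ c) ≡ ParkLex (a ⊗ ParkLex (b ⊗ c))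
  ParkLex-assoc = begin
    ParkLex (ParkLex (a ⊗ b) ⊗ c)   ≡⟨ cong (λ t → ParkLex (t ⊗ c)) (ParkLex⊗≡Park∘encode K a b (small pf-b)) ⟩
    ParkLex (Park ab ⊗ c)           ≡⟨ cong (λ t → ParkLex (Park ab ⊗ t)) (Park-pf c pf-c) ⟨
    ParkLex (Park ab ⊗ Park c)      ≡⟨ ParkLex-Park⊗Park ab c ⟩
    ParkLex (ab ⊗ c)                ≡⟨ ParkLex⊗≡Park∘encode K ab c (small pf-c) ⟩
    Park (Vec.map (encode K) (ab ⊗ c))               ≡⟨ cong Park (encode-assoc K a b c) ⟩
    Park (Vec.map (encode (K ℕ.* K)) (a ⊗ bc))       ≡⟨ ParkLex⊗≡Park∘encode (K ℕ.* K) a bc small-bc ⟨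
    ParkLex (a ⊗ bc)                ≡⟨ ParkLex-Park⊗Park a bc ⟨
    ParkLex (Park a ⊗ Park bc)      ≡⟨ cong (λ t → ParkLex (t ⊗ Park bc)) (Park-pf a pf-a) ⟩
    ParkLex (a ⊗ Park bc)           ≡⟨ cong (λ t → ParkLex (a ⊗ t)) (ParkLex⊗≡Park∘encode K b c (small pf-c)) ⟨
    ParkLex (a ⊗ ParkLex (b ⊗ c))   ∎
    where open ≡-Reasoning

-- Finite sums

module FiniteSums {A : Set} {plus times : A → A → A} {0# 1# : A}
                  (isCS : IsCommutativeSemiring _≡_ plus times 0# 1#) where

  infixl 6 _⊕_
  infixl 7 _⊛_

  _⊕_ _⊛_ : A → A → A
  _⊕_ = plus
  _⊛_ = times

  open IsCommutativeSemiring isCS using (distribˡ; distribʳ; zeroˡ; zeroʳ)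
    renaming (+-assoc to ⊕-assoc; +-comm to ⊕-comm; *-assoc to ⊛-assoc;
              +-identityˡ to ⊕-identityˡ; +-identityʳ to ⊕-identityʳ)

  sum : List A → A
  sum = foldr _⊕_ 0#

  ∑ : ∀ {B : Set} → List B → (B → A) → A
  ∑ xs f = sum (map f xs)

  when : Bool → A → A
  when b x = if b then x else 0#

  sum-++ : ∀ xs ys → sum (xs ++ ys) ≡ sum xs ⊕ sum ys
  sum-++ []       ys = sym (⊕-identityˡ _)
  sum-++ (x ∷ xs) ys = trans (cong (x ⊕_) (sum-++ xs ys)) (sym (⊕-assoc x _ _))

  sum-concatMap : ∀ {B : Set} (F : B → List A) xs → sum (concatMap F xs) ≡ ∑ xs (sum ∘ F)
  sum-concatMap F []       = refl
  sum-concatMap F (x ∷ xs) = trans (sum-++ (F x) _) (cong (sum (F x) ⊕_) (sum-concatMap F xs))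

  ∑-cong : ∀ {B : Set} (xs : List B) {f g : B → A} → (∀ x → f x ≡ g x) → ∑ xs f ≡ ∑ xs g
  ∑-cong xs f≗g = cong sum (List.map-cong f≗g xs)

  ∑-zero : ∀ {B : Set} (xs : List B) → ∑ xs (λ _ → 0#) ≡ 0#
  ∑-zero []       = refl
  ∑-zero (x ∷ xs) = trans (cong (0# ⊕_) (∑-zero xs)) (⊕-identityˡ 0#)

  ∑-⊕ : ∀ {B : Set} (xs : List B) f g → ∑ xs (λ x → f x ⊕ g x) ≡ ∑ xs f ⊕ ∑ xs g
  ∑-⊕ []       f g = sym (⊕-identityˡ 0#)
  ∑-⊕ (x ∷ xs) f g = trans (cong (f x ⊕ g x ⊕_) (∑-⊕ xs f g)) (middle-swap (f x) (g x) _ _)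
    where
      middle-swap : ∀ a b c d → (a ⊕ b) ⊕ (c ⊕ d) ≡ (a ⊕ c) ⊕ (b ⊕ d)
      middle-swap a b c d = begin
        (a ⊕ b) ⊕ (c ⊕ d)   ≡⟨ ⊕-assoc a b _ ⟩
        a ⊕ (b ⊕ (c ⊕ d))   ≡⟨ cong (a ⊕_) (⊕-assoc b c d) ⟨
        a ⊕ ((b ⊕ c) ⊕ d)   ≡⟨ cong (λ t → a ⊕ (t ⊕ d)) (⊕-comm b c) ⟩
        a ⊕ ((c ⊕ b) ⊕ d)   ≡⟨ cong (a ⊕_) (⊕-assoc c b d) ⟩
        a ⊕ (c ⊕ (b ⊕ d))   ≡⟨ ⊕-assoc a c _ ⟨
        (a ⊕ c) ⊕ (b ⊕ d)   ∎
        where open ≡-Reasoning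

  ∑-comm : ∀ {B C : Set} (xs : List B) (ys : List C) (f : B → C → A) →
           ∑ xs (λ x → ∑ ys (f x)) ≡ ∑ ys (λ y → ∑ xs (λ x → f x y))
  ∑-comm []       ys f = sym (∑-zero ys)
  ∑-comm (x ∷ xs) ys f = trans (cong (∑ ys (f x) ⊕_) (∑-comm xs ys f)) (sym (∑-⊕ ys (f x) _))

  ⊛-∑ : ∀ {B : Set} c (xs : List B) f → c ⊛ ∑ xs f ≡ ∑ xs (λ x → c ⊛ f x)
  ⊛-∑ c []       f = zeroʳ c
  ⊛-∑ c (x ∷ xs) f = trans (distribˡ c _ _) (cong (c ⊛ f x ⊕_) (⊛-∑ c xs f))

  ∑-⊛ : ∀ {B : Set} c (xs : List B) f → ∑ xs f ⊛ c ≡ ∑ xs (λ x → f x ⊛ c)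
  ∑-⊛ c []       f = zeroˡ c
  ∑-⊛ c (x ∷ xs) f = trans (distribʳ c _ _) (cong (f x ⊛ c ⊕_) (∑-⊛ c xs f))

  ∑-map : ∀ {B C : Set} (g : B → C) (xs : List B) f → ∑ (map g xs) f ≡ ∑ xs (f ∘ g)
  ∑-map g xs f = cong sum (sym (List.map-∘ xs))

  when-∑ : ∀ {B : Set} b (xs : List B) f → when b (∑ xs f) ≡ ∑ xs (λ x → when b (f x))
  when-∑ true  xs f = refl
  when-∑ false xs f = sym (∑-zero xs)

  when-⊛ : ∀ b x y → when b x ⊛ y ≡ when b (x ⊛ y)
  when-⊛ true  x y = refl
  when-⊛ false x y = zeroˡ y

  ⊛-when : ∀ b x y → x ⊛ when b y ≡ when b (x ⊛ y)
  ⊛-when true  x y = refl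
  ⊛-when false x y = zeroʳ x

  when-comm : ∀ b c x → when b (when c x) ≡ when c (when b x)
  when-comm true  c     x = refl
  when-comm false true  x = refl
  when-comm false false x = refl

  ∑-applyUpTo-single : ∀ m (f : ℕ → ℕ) (g : ℕ → A) {i₀} → i₀ < m → (∀ i → i ≢ i₀ → g (f i) ≡ 0#) →
                       ∑ (applyUpTo f m) g ≡ g (f i₀)
  ∑-applyUpTo-single (suc m) f g {zero} _ others = begin
    g (f 0) ⊕ ∑ (applyUpTo (f ∘ suc) m) g  ≡⟨ cong (g (f 0) ⊕_) (all-zero m (f ∘ suc) (λ i → others (suc i) λ ())) ⟩
    g (f 0) ⊕ 0#                           ≡⟨ ⊕-identityʳ _ ⟩
    g (f 0)                                ∎
    where
      open ≡-Reasoning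
      all-zero : ∀ m (f : ℕ → ℕ) → (∀ i → g (f i) ≡ 0#) → ∑ (applyUpTo f m) g ≡ 0#
      all-zero zero    f z = refl
      all-zero (suc m) f z = trans (cong₂ _⊕_ (z 0) (all-zero m (f ∘ suc) (z ∘ suc))) (⊕-identityˡ 0#)
  ∑-applyUpTo-single (suc m) f g {suc i₀} (s≤s i₀<m) others = begin
    g (f 0) ⊕ ∑ (applyUpTo (f ∘ suc) m) g  ≡⟨ cong₂ _⊕_ (others 0 λ ()) (∑-applyUpTo-single m (f ∘ suc) g i₀<m
                                                 (λ i i≢ → others (suc i) (i≢ ∘ suc-injective))) ⟩
    0# ⊕ g (f (suc i₀))                    ≡⟨ ⊕-identityˡ _ ⟩
    g (f (suc i₀))                         ∎
    where open ≡-Reasoning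

  -- select: the product of two basis words is the word of exactly one basis element.
  module Convolution {B W : Set} (basis : List B) (word : B → W) (_≟_ : DecidableEquality W) (μ : W → W → W)
    (select : ∀ a b (G : W → A) →
              ∑ basis (λ e → when (does (μ (word a) (word b) ≟ word e)) (G (word e))) ≡ G (μ (word a) (word b)))
    (μ-assoc : ∀ a b c → μ (μ (word a) (word b)) (word c) ≡ μ (word a) (μ (word b) (word c))) where

    hit : B → B → B → Bool
    hit a b c = does (μ (word a) (word b) ≟ word c)

    _⋆_ : (B → A) → (B → A) → B → A
    (x ⋆ y) c = ∑ basis λ a → ∑ basis λ b → when (hit a b c) (x a ⊛ y b)

    ⋆-cong : ∀ {x x' y y'} → (∀ a → x a ≡ x' a) → (∀ b → y b ≡ y' b) → ∀ c → (x ⋆ y) c ≡ (x' ⋆ y') c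
    ⋆-cong x≗x' y≗y' c = ∑-cong basis λ a → ∑-cong basis λ b →
      cong₂ (λ s t → when (hit a b c) (s ⊛ t)) (x≗x' a) (y≗y' b)

    private
      ∑∑ : (B → B → A) → A
      ∑∑ f = ∑ basis λ a → ∑ basis λ b → f a b

      ∑∑∑ : (B → B → B → A) → A
      ∑∑∑ f = ∑ basis λ a → ∑ basis λ b → ∑ basis λ c → f a b c

      when-∑∑ : ∀ q f → when q (∑∑ f) ≡ ∑∑ (λ a b → when q (f a b))
      when-∑∑ q f = trans (when-∑ q basis _) (∑-cong basis λ a → when-∑ q basis _)

    module _ (x y z : B → A) (c : B) where

      ⋆-assocˡ : ((x ⋆ y) ⋆ z) c ≡
                 ∑∑∑ (λ a b k → when (does (μ (μ (word a) (word b)) (word k) ≟ word c)) (x a ⊛ y b ⊛ z k))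
      ⋆-assocˡ = begin
        ((x ⋆ y) ⋆ z) c
          ≡⟨ ∑-cong basis (λ e → ∑-cong basis λ k → expand e k) ⟩
        ∑ basis (λ e → ∑ basis λ k → ∑∑ λ a b → when (hit a b e) (when (hit e k c) (x a ⊛ y b ⊛ z k)))
          ≡⟨ ∑-comm basis basis _ ⟩
        ∑ basis (λ k → ∑ basis λ e → ∑∑ λ a b → when (hit a b e) (when (hit e k c) (x a ⊛ y b ⊛ z k)))
          ≡⟨ ∑-cong basis (λ k → trans (∑-comm basis basis _) (∑-cong basis λ a → ∑-comm basis basis _)) ⟩
        ∑ basis (λ k → ∑∑ λ a b → ∑ basis λ e → when (hit a b e) (when (hit e k c) (x a ⊛ y b ⊛ z k)))
          ≡⟨ ∑-cong basis (λ k → ∑-cong basis λ a → ∑-cong basis λ b →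
               select a b (λ w → when (does (μ w (word k) ≟ word c)) (x a ⊛ y b ⊛ z k))) ⟩
        ∑ basis (λ k → ∑∑ λ a b → when (does (μ (μ (word a) (word b)) (word k) ≟ word c)) (x a ⊛ y b ⊛ z k))
          ≡⟨ trans (∑-comm basis basis _) (∑-cong basis λ a → ∑-comm basis basis _) ⟩
        ∑∑∑ (λ a b k → when (does (μ (μ (word a) (word b)) (word k) ≟ word c)) (x a ⊛ y b ⊛ z k))
          ∎
        where
          open ≡-Reasoning
          expand : ∀ e k → when (hit e k c) ((x ⋆ y) e ⊛ z k) ≡
                           ∑∑ λ a b → when (hit a b e) (when (hit e k c) (x a ⊛ y b ⊛ z k))
          expand e k = begin
            when (hit e k c) ((x ⋆ y) e ⊛ z k)
              ≡⟨ cong (when (hit e k c)) (trans (∑-⊛ (z k) basis _) (∑-cong basis λ a →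
                   trans (∑-⊛ (z k) basis _) (∑-cong basis λ b → when-⊛ (hit a b e) _ (z k)))) ⟩
            when (hit e k c) (∑∑ λ a b → when (hit a b e) (x a ⊛ y b ⊛ z k))
              ≡⟨ trans (when-∑∑ (hit e k c) _)
                       (∑-cong basis λ a → ∑-cong basis λ b → when-comm (hit e k c) (hit a b e) _) ⟩
            ∑∑ (λ a b → when (hit a b e) (when (hit e k c) (x a ⊛ y b ⊛ z k)))
              ∎

      ⋆-assocʳ : (x ⋆ (y ⋆ z)) c ≡
                 ∑∑∑ (λ a b k → when (does (μ (word a) (μ (word b) (word k)) ≟ word c)) (x a ⊛ (y b ⊛ z k)))
      ⋆-assocʳ = begin
        (x ⋆ (y ⋆ z)) c
          ≡⟨ ∑-cong basis (λ a → ∑-cong basis λ e → expand a e) ⟩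
        ∑ basis (λ a → ∑ basis λ e → ∑∑ λ b k → when (hit b k e) (when (hit a e c) (x a ⊛ (y b ⊛ z k))))
          ≡⟨ ∑-cong basis (λ a → trans (∑-comm basis basis _) (∑-cong basis λ b → ∑-comm basis basis _)) ⟩
        ∑∑∑ (λ a b k → ∑ basis λ e → when (hit b k e) (when (hit a e c) (x a ⊛ (y b ⊛ z k))))
          ≡⟨ ∑-cong basis (λ a → ∑-cong basis λ b → ∑-cong basis λ k →
               select b k (λ w → when (does (μ (word a) w ≟ word c)) (x a ⊛ (y b ⊛ z k)))) ⟩
        ∑∑∑ (λ a b k → when (does (μ (word a) (μ (word b) (word k)) ≟ word c)) (x a ⊛ (y b ⊛ z k)))
          ∎
        where
          open ≡-Reasoning
          expand : ∀ a e → when (hit a e c) (x a ⊛ (y ⋆ z) e) ≡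
                           ∑∑ λ b k → when (hit b k e) (when (hit a e c) (x a ⊛ (y b ⊛ z k)))
          expand a e = begin
            when (hit a e c) (x a ⊛ (y ⋆ z) e)
              ≡⟨ cong (when (hit a e c)) (trans (⊛-∑ (x a) basis _) (∑-cong basis λ b →
                   trans (⊛-∑ (x a) basis _) (∑-cong basis λ k → ⊛-when (hit b k e) (x a) _))) ⟩
            when (hit a e c) (∑∑ λ b k → when (hit b k e) (x a ⊛ (y b ⊛ z k)))
              ≡⟨ trans (when-∑∑ (hit a e c) _)
                       (∑-cong basis λ b → ∑-cong basis λ k → when-comm (hit a e c) (hit b k e) _) ⟩
            ∑∑ (λ b k → when (hit b k e) (when (hit a e c) (x a ⊛ (y b ⊛ z k))))
              ∎

      ⋆-assoc : ((x ⋆ y) ⋆ z) c ≡ (x ⋆ (y ⋆ z)) c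
      ⋆-assoc = begin
        ((x ⋆ y) ⋆ z) c  ≡⟨ ⋆-assocˡ ⟩
        ∑∑∑ _            ≡⟨ ∑-cong basis (λ a → ∑-cong basis λ b → ∑-cong basis λ k →
                              cong₂ (λ w t → when (does (w ≟ word c)) t) (μ-assoc a b k) (⊛-assoc (x a) (y b) (z k))) ⟩
        ∑∑∑ _            ≡⟨ ⋆-assocʳ ⟨
        (x ⋆ (y ⋆ z)) c  ∎
        where open ≡-Reasoning

  ∑-mapMaybe-toPF : ∀ {n} (ws : List (Vec ℕ n)) (h : Vec ℕ n → A) → (∀ w → ¬ T (isPF w) → h w ≡ 0#) →
                    ∑ (mapMaybe toPF ws) (h ∘ proj₁) ≡ ∑ ws h
  ∑-mapMaybe-toPF []       h _    = refl
  ∑-mapMaybe-toPF (w ∷ ws) h off with T? (isPF w)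
  ... | yes _  = cong (h w ⊕_) (∑-mapMaybe-toPF ws h off)
  ... | no ¬pf = begin
    ∑ (mapMaybe toPF ws) (h ∘ proj₁)   ≡⟨ ∑-mapMaybe-toPF ws h off ⟩
    ∑ ws h                             ≡⟨ ⊕-identityˡ _ ⟨
    0# ⊕ ∑ ws h                        ≡⟨ cong (_⊕ ∑ ws h) (off w ¬pf) ⟨
    h w ⊕ ∑ ws h                       ∎
    where open ≡-Reasoning

  when-≟w-∷ : ∀ {n} x (p : Vec ℕ n) y w v →
              when (does ((x Vec.∷ p) ≟w (y Vec.∷ w))) v ≡ when (does (x ≟ y)) (when (does (p ≟w w)) v)
  when-≟w-∷ x p y w v with does (x ≟ y) | does (p ≟w w)
  ... | true  | true  = refl
  ... | true  | false = refl
  ... | false | _     = refl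

  ∑-range-select : ∀ m {x} → 1 ≤ x → x ≤ m → (F : ℕ → A) →
                   ∑ (map suc (upTo m)) (λ y → when (does (x ≟ y)) (F y)) ≡ F x
  ∑-range-select m {x} 1≤x x≤m F = begin
    ∑ (map suc (upTo m)) (λ y → when (does (x ≟ y)) (F y))      ≡⟨ ∑-map suc (upTo m) _ ⟩
    ∑ (upTo m) (λ i → when (does (x ≟ suc i)) (F (suc i)))      ≡⟨ ∑-applyUpTo-single m id _ pred-x<m others ⟩
    when (does (x ≟ suc (pred x))) (F (suc (pred x)))           ≡⟨ selected ⟩
    F x                                                         ∎
    where
      open ≡-Reasoning
      suc-pred-x : suc (pred x) ≡ x
      suc-pred-x = suc-pred x {{>-nonZero 1≤x}}
      pred-x<m : pred x < m
      pred-x<m = subst (_≤ m) (sym suc-pred-x) x≤m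
      others : ∀ i → i ≢ pred x → when (does (x ≟ suc i)) (F (suc i)) ≡ 0#
      others i i≢ rewrite ≢⇒≡ᵇ≡false {x} {suc i} (λ x≡ → i≢ (cong pred (sym x≡))) = refl
      selected : when (does (x ≟ suc (pred x))) (F (suc (pred x))) ≡ F x
      selected rewrite suc-pred-x | ≡⇒≡ᵇ≡true {x} refl = refl

  ∑-allWords-select : ∀ k m (p : Vec ℕ k) → (∀ {y} → y ∈ toList p → 1 ≤ y × y ≤ m) → (G : Vec ℕ k → A) →
                      ∑ (allWords k m) (λ w → when (does (p ≟w w)) (G w)) ≡ G p
  ∑-allWords-select zero    m Vec.[]       _      G = ⊕-identityʳ (G Vec.[])
  ∑-allWords-select (suc k) m (x Vec.∷ p) bounds G = begin
    ∑ (allWords (suc k) m) (λ w → when (does ((x Vec.∷ p) ≟w w)) (G w))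
      ≡⟨ cong sum (List.map-concatMap _ _ (map suc (upTo m))) ⟩
    sum (concatMap (λ y → map (λ w → when (does ((x Vec.∷ p) ≟w w)) (G w)) (map (y Vec.∷_) (allWords k m)))
                   (map suc (upTo m)))
      ≡⟨ sum-concatMap _ (map suc (upTo m)) ⟩
    ∑ (map suc (upTo m)) (λ y → ∑ (map (y Vec.∷_) (allWords k m)) (λ w → when (does ((x Vec.∷ p) ≟w w)) (G w)))
      ≡⟨ ∑-cong (map suc (upTo m)) tail-selected ⟩
    ∑ (map suc (upTo m)) (λ y → when (does (x ≟ y)) (G (y Vec.∷ p)))
      ≡⟨ ∑-range-select m (proj₁ (bounds (here refl))) (proj₂ (bounds (here refl))) (λ y → G (y Vec.∷ p)) ⟩
    G (x Vec.∷ p)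
      ∎
    where
      open ≡-Reasoning
      tail-selected : ∀ y → ∑ (map (y Vec.∷_) (allWords k m)) (λ w → when (does ((x Vec.∷ p) ≟w w)) (G w))
                          ≡ when (does (x ≟ y)) (G (y Vec.∷ p))
      tail-selected y = begin
        ∑ (map (y Vec.∷_) (allWords k m)) (λ w → when (does ((x Vec.∷ p) ≟w w)) (G w))
          ≡⟨ ∑-map (y Vec.∷_) (allWords k m) _ ⟩
        ∑ (allWords k m) (λ w → when (does ((x Vec.∷ p) ≟w (y Vec.∷ w))) (G (y Vec.∷ w)))
          ≡⟨ ∑-cong (allWords k m) (λ w → when-≟w-∷ x p y w _) ⟩
        ∑ (allWords k m) (λ w → when (does (x ≟ y)) (when (does (p ≟w w)) (G (y Vec.∷ w))))
          ≡⟨ when-∑ (does (x ≟ y)) (allWords k m) _ ⟨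
        when (does (x ≟ y)) (∑ (allWords k m) (λ w → when (does (p ≟w w)) (G (y Vec.∷ w))))
          ≡⟨ cong (when (does (x ≟ y))) (∑-allWords-select k m p (bounds ∘ there) (G ∘ (y Vec.∷_))) ⟩
        when (does (x ≟ y)) (G (y Vec.∷ p))
          ∎

  ∑-pfs-select : ∀ {n} (p : Vec ℕ n) → T (isPF p) → (G : Vec ℕ n → A) →
                 ∑ (pfs n) (λ e → when (does (p ≟w proj₁ e)) (G (proj₁ e))) ≡ G p
  ∑-pfs-select {n} p pf G = begin
    ∑ (pfs n) (λ e → when (does (p ≟w proj₁ e)) (G (proj₁ e)))  ≡⟨ ∑-mapMaybe-toPF (allWords n n) _ off-pf ⟩
    ∑ (allWords n n) (λ w → when (does (p ≟w w)) (G w))          ≡⟨ ∑-allWords-select n n p (isPF-bounds p pf) G ⟩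
    G p                                                          ∎
    where
      open ≡-Reasoning
      off-pf : ∀ w → ¬ T (isPF w) → when (does (p ≟w w)) (G w) ≡ 0#
      off-pf w ¬pf with p ≟w w
      ... | yes refl = ⊥-elim (¬pf pf)
      ... | no  _    = refl

module _ {n : ℕ} where

  private
    μ : Vec ℕ n → Vec ℕ n → Vec ℕ n
    μ a b = ParkLex (a ⊗ b)

  module ℤ-PQSym where
    open FiniteSums ℤ.+-*-isCommutativeSemiring
    open Convolution (pfs n) proj₁ _≟w_ μ
      (λ a b → ∑-pfs-select (μ (proj₁ a) (proj₁ b)) (ParkLex-isPF (proj₁ a) (proj₁ b) (proj₂ b)))
      (λ a b c → ParkLex-assoc (proj₁ a) (proj₁ b) (proj₁ c) (proj₂ a) (proj₂ b) (proj₂ c))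

    *≡⋆ : ∀ (x y : PQSym n) c → (x * y) c ≡ (x ⋆ y) c
    *≡⋆ x y c = sum-concatMap _ (pfs n)

    *-associative : ∀ (x y z : PQSym n) c → ((x * y) * z) c ≡ (x * (y * z)) c
    *-associative x y z c = begin
      ((x * y) * z) c  ≡⟨ *≡⋆ (x * y) z c ⟩
      ((x * y) ⋆ z) c  ≡⟨ ⋆-cong {y = z} (*≡⋆ x y) (λ _ → refl) c ⟩
      ((x ⋆ y) ⋆ z) c  ≡⟨ ⋆-assoc x y z c ⟩
      (x ⋆ (y ⋆ z)) c  ≡⟨ ⋆-cong {x = x} (λ _ → refl) (*≡⋆ y z) c ⟨
      (x ⋆ (y * z)) c  ≡⟨ *≡⋆ x (y * z) c ⟨
      (x * (y * z)) c  ∎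
      where open ≡-Reasoning

  module ℕ-coefficients where
    open FiniteSums +-*-isCommutativeSemiring

    [≡w]-* : ∀ (u v : Vec ℕ n) g → [ u ≡w v ] ℕ.* g ≡ when (does (u ≟w v)) g
    [≡w]-* u v g with does (u ≟w v)
    ... | true  = +-identityʳ g
    ... | false = refl

    select : ∀ (p : Vec ℕ n) → T (isPF p) → (G : Vec ℕ n → ℕ) →
             ∑ (pfs n) (λ e → [ p ≡w proj₁ e ] ℕ.* G (proj₁ e)) ≡ G p
    select p pf G = trans (∑-cong (pfs n) (λ e → [≡w]-* p (proj₁ e) _)) (∑-pfs-select p pf G)

    coassoc : ∀ (a b c d : PF n) → coassocL a b c d ≡ coassocR a b c d
    coassoc (a , pf-a) (b , pf-b) (c , pf-c) (d , pf-d) = begin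
      coassocL (a , pf-a) (b , pf-b) (c , pf-c) (d , pf-d)
        ≡⟨ select (μ a b) (ParkLex-isPF a b pf-b) (λ e → [ μ e c ≡w d ]) ⟩
      [ μ (μ a b) c ≡w d ]
        ≡⟨ cong [_≡w d ] (ParkLex-assoc a b c pf-a pf-b pf-c) ⟩
      [ μ a (μ b c) ≡w d ]
        ≡⟨ select (μ b c) (ParkLex-isPF b c pf-c) (λ e → [ μ a e ≡w d ]) ⟨
      coassocR (a , pf-a) (b , pf-b) (c , pf-c) (d , pf-d)
        ∎
      where open ≡-Reasoning

    coeffLHS≡coeffRHS : ∀ (a : PF n) (u v : Vec ℕ n) → coeffLHS a u v ≡ coeffRHS a u v
    coeffLHS≡coeffRHS (a , pf-a) u v = sym (begin
      coeffRHS (a , pf-a) u v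
        ≡⟨ sum-concatMap _ (pfs n) ⟩
      ∑ (pfs n) (λ a' → ∑ (pfs n) λ a'' →
        [ μ (proj₁ a') (proj₁ a'') ≡w a ] ℕ.* [ Park u ≡w proj₁ a' ] ℕ.* [ Park v ≡w proj₁ a'' ])
        ≡⟨ ∑-cong (pfs n) (λ a' → trans (∑-cong (pfs n) λ a'' →
               *-comm ([ μ (proj₁ a') (proj₁ a'') ≡w a ] ℕ.* [ Park u ≡w proj₁ a' ]) [ Park v ≡w proj₁ a'' ])
             (select (Park v) (Park-isPF v) (λ e → [ μ (proj₁ a') e ≡w a ] ℕ.* [ Park u ≡w proj₁ a' ]))) ⟩
      ∑ (pfs n) (λ a' → [ μ (proj₁ a') (Park v) ≡w a ] ℕ.* [ Park u ≡w proj₁ a' ])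
        ≡⟨ ∑-cong (pfs n) (λ a' → *-comm [ μ (proj₁ a') (Park v) ≡w a ] [ Park u ≡w proj₁ a' ]) ⟩
      ∑ (pfs n) (λ a' → [ Park u ≡w proj₁ a' ] ℕ.* [ μ (proj₁ a') (Park v) ≡w a ])
        ≡⟨ select (Park u) (Park-isPF u) (λ e → [ μ e (Park v) ≡w a ]) ⟩
      [ μ (Park u) (Park v) ≡w a ]
        ≡⟨ cong [_≡w a ] (ParkLex-Park⊗Park u v) ⟩
      coeffLHS (a , pf-a) u v
        ∎)
      where open ≡-Reasoning

mainTheorem1 : (n : ℕ) →
    ((x y z : PQSym n) (c : PF n) → ((x * y) * z) c ≡ (x * (y * z)) c)
    × ((a b c d : PF n) → coassocL a b c d ≡ coassocR a b c d)
    × ((a : PF n) (u v : Vec ℕ n) → Positive u → Positive v →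
         coeffLHS a u v ≡ coeffRHS a u v)
mainTheorem1 n =
    ℤ-PQSym.*-associative
  , ℕ-coefficients.coassoc
  , λ a u v _ _ → ℕ-coefficients.coeffLHS≡coeffRHS a u v
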